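{- Let $e\ge2$, $w\in\tilde{\mathfrak S}_e$, and let $\boldsymbol\lambda=w\cdot\boldsymbol\emptyset=(w\cdot\emptyset_0,\dots,w\cdot\emptyset_{e-1})$. Let $i\in\{0,\dots,e-1\}$. Then $\ell(s_iw)<\ell(w)$ if and only if $\boldsymbol\lambda$ has a removable $i$-node, and $\ell(s_iw)>\ell(w)$ if and only if $\boldsymbol\lambda$ has an addable $i$-node. In particular $\boldsymbol\lambda$ has either an addable or a removable $i$-node.
   Context: The affine symmetric group $\tilde{\mathfrak S}_e$ is the group of bijections $w:\mathbb Z\to\mathbb Z$ with $w(i+e)=w(i)+e$ and $w(1)+\dots+w(e)=e(e+1)/2$; it is the Coxeter group with generators $s_0,\dots,s_{e-1}$ ($s_i$ swaps $i+ke$ and $i+1+ke$ for all $k$) and length function $\ell$. A $c$-charged partition is a partition $\lambda=(\lambda_1\ge\dots\ge\lambda_h>0)$ with an integer $c$; its abacus is $\{\lambda_k-k+c+1:k\ge1\}$ ($\lambda_k=0$ for $k>h$), and every subset of $\mathbb Z$ containing all sufficiently negative and no sufficiently large integers is the abacus of a unique charged partition. $w\cdot\lambda$ is the charged partition with abacus $w(A)$; $\emptyset_c$ is the empty $c$-charged partition. Young diagram $Y(\lambda)=\{(a,b):1\le a\le h,1\le b\le\lambda_a\}$; the residue of node $(a,b)$ for charge $c$ is $b-a+c\bmod e$, and an $i$-node is a node of residue $i$. A node $\gamma\notin Y(\lambda)$ is addable if $Y(\lambda)\cup\{\gamma\}$ is a Young diagram; $\gamma\in Y(\lambda)$ is removable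 if $Y(\lambda)\setminus\{\gamma\}$ is a Young diagram. A tuple of charged partitions has an addable (removable) $i$-node if some component does. -}

module Defs where

open import Data.Nat as ℕ using (ℕ; zero; suc; NonZero; _≤_; _<_)
open import Data.Nat.DivMod using (_%_)
open import Data.Integer as ℤ using (ℤ; +_)
open import Data.Integer.DivMod using (_%ℕ_)
open import Data.Fin using (Fin; toℕ)
open import Data.List using (List; []; _∷_; length; map; foldr; upTo)
open import Data.List.Relation.Unary.All using (All)
open import Data.List.Relation.Unary.Linked using (Linked)
open import Data.Product using (Σ; _×_; ∃; ∃-syntax)
open import Data.Sum using (_⊎_)
open import Data.Bool using (if_then_else_)
open import Relation.Nullary using (¬_)
open import Relation.Nullary.Decidable using (⌊_⌋)
open import Relation.Binary.PropositionalEquality using (_≡_; _≢_)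
open import Function using (_∘_; id; _⇔_)
open import Function.Definitions using (Bijective)

sumℤ : List ℤ → ℤ
sumℤ = foldr ℤ._+_ (+ 0)

windowSum : ℕ → (ℤ → ℤ) → ℤ
windowSum e w = sumℤ (map (λ k → w (+ suc k)) (upTo e))

record AffPerm (e : ℕ) : Set where
  field
    fun      : ℤ → ℤ
    bij      : Bijective _≡_ _≡_ fun
    periodic : ∀ (x : ℤ) → fun (x ℤ.+ + e) ≡ fun x ℤ.+ + e
    sumCond  : windowSum e fun ≡ + ((e ℕ.* suc e) ℕ./ 2)
open AffPerm public

-- the generator s_i : swaps i + ke and i + 1 + ke for all k
gen : (e : ℕ) → .{{_ : NonZero e}} → Fin e → ℤ → ℤ
gen e i x =
  if ⌊ (x %ℕ e) ℕ.≟ toℕ i ⌋ then x ℤ.+ + 1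
  else if ⌊ (x %ℕ e) ℕ.≟ (suc (toℕ i) % e) ⌋ then x ℤ.- + 1
  else x

evalWord : (e : ℕ) → .{{_ : NonZero e}} → List (Fin e) → ℤ → ℤ
evalWord e []       = id
evalWord e (i ∷ ws) = gen e i ∘ evalWord e ws

ProductOfGens : (e : ℕ) → .{{_ : NonZero e}} → (ℤ → ℤ) → ℕ → Set
ProductOfGens e f n =
  Σ (List (Fin e)) λ ws → (length ws ≡ n) × (∀ x → evalWord e ws x ≡ f x)

IsLength : (e : ℕ) → .{{_ : NonZero e}} → (ℤ → ℤ) → ℕ → Set
IsLength e f n = ProductOfGens e f n × (∀ m → ProductOfGens e f m → n ≤ m)

IsPartition : List ℕ → Set
IsPartition xs = All (0 <_) xs × Linked ℕ._≥_ xs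

-- λ_k (1-indexed), with λ_k = 0 for k > h
part : List ℕ → ℕ → ℕ
part []       _             = 0
part (x ∷ xs) zero          = 0
part (x ∷ xs) (suc zero)    = x
part (x ∷ xs) (suc (suc k)) = part xs (suc k)

record ChargedPartition : Set where
  field
    charge  : ℤ
    parts   : List ℕ
    isPart  : IsPartition parts
open ChargedPartition public

InAbacus : ChargedPartition → ℤ → Set
InAbacus λ' x = ∃[ k ] (1 ≤ k × x ≡ + part (parts λ') k ℤ.- + k ℤ.+ charge λ' ℤ.+ + 1)

HasAbacus : ChargedPartition → (ℤ → Set) → Set
HasAbacus λ' S = ∀ x → (InAbacus λ' x ⇔ S x)

-- w(A) where A = {y : y ≤ c} is the abacus of ∅_c
ImageOfEmptyAbacus : (ℤ → ℤ) → ℤ → ℤ → Set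
ImageOfEmptyAbacus w c x = ∃[ y ] (y ℤ.≤ c × w y ≡ x)

Node : Set
Node = ℕ × ℕ

InY : List ℕ → Node → Set
InY xs (a Data.Product., b) = 1 ≤ a × 1 ≤ b × b ≤ part xs a

Addable : List ℕ → Node → Set
Addable xs γ = ¬ InY xs γ ×
  ∃[ ys ] (IsPartition ys × (∀ δ → (InY ys δ ⇔ (InY xs δ ⊎ δ ≡ γ))))

Removable : List ℕ → Node → Set
Removable xs γ = InY xs γ ×
  ∃[ ys ] (IsPartition ys × (∀ δ → (InY ys δ ⇔ (InY xs δ × δ ≢ γ))))

residue : (e : ℕ) → .{{_ : NonZero e}} → ℤ → Node → ℕ
residue e c (a Data.Product., b) = (+ b ℤ.- + a ℤ.+ c) %ℕ e

HasAddable : (e : ℕ) → .{{_ : NonZero e}} → (Fin e → ChargedPartition) → Fin e → Set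
HasAddable e λs i = ∃[ c ] ∃[ γ ]
  (Addable (parts (λs c)) γ × residue e (charge (λs c)) γ ≡ toℕ i)

HasRemovable : (e : ℕ) → .{{_ : NonZero e}} → (Fin e → ChargedPartition) → Fin e → Set
HasRemovable e λs i = ∃[ c ] ∃[ γ ]
  (Removable (parts (λs c)) γ × residue e (charge (λs c)) γ ≡ toℕ i)

module Submission where

-- Write w = ⟦ ws ⟧ as a word in the generators and put P = w⁻¹(i), Q = w⁻¹(i + 1).
-- Length equals the number of inversions of w counted up to translation by e,
-- and sᵢ only exchanges the values i + te and i + 1 + te, so sᵢ w and w order
-- exactly the same pairs except the translates of (P, Q): ℓ(sᵢ w) = ℓ(w) + 1 if
-- P < Q and ℓ(w) - 1 if Q < P.  On the partition side, the c-th component of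
-- w·∅ has abacus w({y ≤ c}), and a node of content x is addable (removable)
-- exactly when x is a bead and x + 1 is not (x is not a bead and x + 1 is).
-- For x = i + te we have x = w(P + te) and x + 1 = w(Q + te), so some charge c
-- shows this configuration precisely when P < Q (resp. Q < P).

open import Data.Bool using (if_then_else_)
open import Data.Fin using (Fin; toℕ; fromℕ<)
import Data.Fin.Properties as FinP
open import Data.Integer as ℤ using (ℤ; +_; -[1+_]; _+_; _*_; _-_; -_; 0ℤ; 1ℤ)
open import Data.Integer.DivMod using (_%ℕ_; _/ℕ_; a≡a%ℕn+[a/ℕn]*n; n%ℕd<d)
import Data.Integer.Properties as ℤP
open import Data.Integer.Tactic.RingSolver using (solve-∀)
open import Data.List using (List; []; _∷_; length)
open import Data.List.Relation.Unary.All using (All; []; _∷_)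
open import Data.List.Relation.Unary.Linked as Linked using (Linked; []; [-]; _∷_)
open import Data.Nat as ℕ using (ℕ; zero; suc; NonZero; z≤n; s≤s; _≤_; _<_)
import Data.Nat.DivMod as ℕD
import Data.Nat.Properties as ℕP
open import Data.Product using (_×_; _,_; ∃; ∃-syntax; proj₁; proj₂)
open import Data.Sum as Sum using (_⊎_; inj₁; inj₂; [_,_]′)
open import Function using (_∘_; id; _⇔_; mk⇔; Equivalence; case_of_)
open import Function.Properties.Equivalence using () renaming (sym to ⇔-sym; trans to ⇔-trans)
open import Relation.Binary.Definitions using (tri<; tri≈; tri>)
open import Relation.Binary.PropositionalEquality
open import Relation.Nullary using (¬_; Dec; yes; no; contradiction)
open import Relation.Nullary.Decidable using (⌊_⌋; _×-dec_)
open import Algebra.Properties.AbelianGroup ℤP.+-0-abelianGroup using ()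
  renaming (∙-cancelˡ to +-cancelˡ; ∙-cancelʳ to +-cancelʳ)
open import Algebra.Properties.CommutativeSemigroup ℕP.+-commutativeSemigroup using (xy∙z≈xz∙y)
open import Algebra.Properties.CommutativeSemigroup ℤP.+-commutativeSemigroup using ()
  renaming (interchange to +-interchange; xy∙z≈xz∙y to xy+z≡xz+y)

open import Defs

-- Linear inequalities are proved by writing b - a (or b - a - 1) as a visibly
-- nonnegative term; the identity itself is left to the ring solver.

j-[1+i]≡j-i-1 : ∀ i j → j - (1ℤ + i) ≡ j - i - 1ℤ
j-[1+i]≡j-i-1 = solve-∀

≤-from-diff : ∀ {a b t} → 0ℤ ℤ.≤ t → b - a ≡ t → a ℤ.≤ b
≤-from-diff {a} {b} 0≤t b-a≡t = ℤP.0≤i-j⇒j≤i (subst (0ℤ ℤ.≤_) (sym b-a≡t) 0≤t)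

<-from-diff : ∀ {a b t} → 0ℤ ℤ.≤ t → b - a - 1ℤ ≡ t → a ℤ.< b
<-from-diff {a} {b} 0≤t b-a-1≡t = ℤP.suc[i]≤j⇒i<j (≤-from-diff 0≤t (trans (j-[1+i]≡j-i-1 a b) b-a-1≡t))

i<j⇒0≤j-i-1 : ∀ {a b} → a ℤ.< b → 0ℤ ℤ.≤ b - a - 1ℤ
i<j⇒0≤j-i-1 {a} {b} a<b = subst (0ℤ ℤ.≤_) (j-[1+i]≡j-i-1 a b) (ℤP.i≤j⇒0≤j-i (ℤP.i<j⇒suc[i]≤j a<b))

i+1-1≡i : ∀ i → i + 1ℤ - 1ℤ ≡ i
i+1-1≡i = solve-∀

i-1+1≡i : ∀ i → i - 1ℤ + 1ℤ ≡ i
i-1+1≡i = solve-∀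

0≤+ : ∀ n → 0ℤ ℤ.≤ + n
0≤+ n = ℤ.+≤+ z≤n

i<i+1 : ∀ i → i ℤ.< i + 1ℤ
i<i+1 i = <-from-diff (0≤+ 0) (simplify i)
  where
  simplify : ∀ i → i + 1ℤ - i - 1ℤ ≡ 0ℤ
  simplify = solve-∀

i-1<i : ∀ i → i - 1ℤ ℤ.< i
i-1<i i = <-from-diff (0≤+ 0) (simplify i)
  where
  simplify : ∀ i → i - (i - 1ℤ) - 1ℤ ≡ 0ℤ
  simplify = solve-∀

+-cancelʳ-< : ∀ {a b} c → a + c ℤ.< b + c → a ℤ.< b
+-cancelʳ-< {a} {b} c a+c<b+c =
  subst₂ ℤ._<_ (cancel a c) (cancel b c) (ℤP.+-monoˡ-< (- c) a+c<b+c)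
  where
  cancel : ∀ a c → a + c + - c ≡ a
  cancel = solve-∀

<⇒≡+suc : ∀ {a b} → a ℤ.< b → ∃[ d ] b ≡ a + + suc d
<⇒≡+suc {a} {b} a<b =
  ℤ.∣ b - a - 1ℤ ∣ ,
  trans (sym (rearrange a b)) (cong (λ t → a + (1ℤ + t)) (sym (ℤP.0≤i⇒+∣i∣≡i (i<j⇒0≤j-i-1 a<b))))
  where
  rearrange : ∀ a b → a + (1ℤ + (b - a - 1ℤ)) ≡ b
  rearrange = solve-∀

i<i+suc : ∀ i d → i ℤ.< i + + suc d
i<i+suc i d = <-from-diff (0≤+ d) (simplify i (+ d))
  where
  simplify : ∀ i d → i + (1ℤ + d) - i - 1ℤ ≡ d
  simplify = solve-∀

module Residues (e : ℕ) .{{_ : NonZero e}} where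

  private
    <-of-quotient-< : ∀ {r r′ q q′} → r < e → q ℤ.< q′ → + r + q * + e ℤ.< + r′ + q′ * + e
    <-of-quotient-< {r} {r′} {q} {q′} r<e q<q′ =
      <-from-diff (ℤP.+-mono-≤ (ℤP.+-mono-≤ (0≤+ r′) (ℤP.*-monoʳ-≤-nonNeg (+ e) (i<j⇒0≤j-i-1 q<q′)))
                               (i<j⇒0≤j-i-1 (ℤ.+<+ r<e)))
                  (regroup (+ r) (+ r′) q q′ (+ e))
      where
      regroup : ∀ r r′ q q′ E → (r′ + q′ * E) - (r + q * E) - 1ℤ ≡ r′ + (q′ - q - 1ℤ) * E + (E - r - 1ℤ)
      regroup = solve-∀

  remainder-unique : ∀ {r r′} q q′ → r < e → r′ < e →
                     + r + q * + e ≡ + r′ + q′ * + e → r ≡ r′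
  remainder-unique {r} {r′} q q′ r<e r′<e eq with ℤP.<-cmp q q′
  ... | tri< q<q′ _ _ = contradiction eq (ℤP.<⇒≢ (<-of-quotient-< r<e q<q′))
  ... | tri> _ _ q′<q = contradiction (sym eq) (ℤP.<⇒≢ (<-of-quotient-< r′<e q′<q))
  ... | tri≈ _ refl _ = ℤP.+-injective (+-cancelʳ (q * + e) (+ r) (+ r′) eq)

  [r+qe]%ℕe≡r : ∀ {r} q → r < e → (+ r + q * + e) %ℕ e ≡ r
  [r+qe]%ℕe≡r {r} q r<e =
    sym (remainder-unique q (x /ℕ e) r<e (n%ℕd<d x e) (a≡a%ℕn+[a/ℕn]*n x e))
    where x = + r + q * + e

  [x+qe]%ℕe≡x%ℕe : ∀ x q → (x + q * + e) %ℕ e ≡ x %ℕ e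
  [x+qe]%ℕe≡x%ℕe x q = trans (cong (_%ℕ e) decomposition) ([r+qe]%ℕe≡r (x /ℕ e + q) (n%ℕd<d x e))
    where
    regroup : ∀ r p q E → r + p * E + q * E ≡ r + (p + q) * E
    regroup = solve-∀
    decomposition : x + q * + e ≡ + (x %ℕ e) + (x /ℕ e + q) * + e
    decomposition = trans (cong (_+ q * + e) (a≡a%ℕn+[a/ℕn]*n x e)) (regroup (+ (x %ℕ e)) (x /ℕ e) q (+ e))

  [x+1]%ℕe≡[1+x%ℕe]%e : ∀ x → (x + 1ℤ) %ℕ e ≡ suc (x %ℕ e) ℕ.% e
  [x+1]%ℕe≡[1+x%ℕe]%e x = trans (cong (_%ℕ e) decomposition) ([r+qe]%ℕe≡r (q + + (suc r ℕ./ e)) (ℕD.m%n<n (suc r) e))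
    where
    r = x %ℕ e
    q = x /ℕ e
    carry : + suc r ≡ + (suc r ℕ.% e) + + (suc r ℕ./ e) * + e
    carry = trans (cong +_ (ℕD.m≡m%n+[m/n]*n (suc r) e))
                  (trans (ℤP.pos-+ (suc r ℕ.% e) _) (cong (λ t → + (suc r ℕ.% e) + t) (ℤP.pos-* (suc r ℕ./ e) e)))
    bring-1-forward : ∀ r q E → r + q * E + 1ℤ ≡ (1ℤ + r) + q * E
    bring-1-forward = solve-∀
    regroup : ∀ r′ c q E → r′ + c * E + q * E ≡ r′ + (q + c) * E
    regroup = solve-∀
    decomposition : x + 1ℤ ≡ + (suc r ℕ.% e) + (q + + (suc r ℕ./ e)) * + e
    decomposition = begin
      x + 1ℤ                                                  ≡⟨ cong (_+ 1ℤ) (a≡a%ℕn+[a/ℕn]*n x e) ⟩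
      + r + q * + e + 1ℤ                                      ≡⟨ bring-1-forward (+ r) q (+ e) ⟩
      + suc r + q * + e                                       ≡⟨ cong (_+ q * + e) carry ⟩
      + (suc r ℕ.% e) + + (suc r ℕ./ e) * + e + q * + e       ≡⟨ regroup (+ (suc r ℕ.% e)) (+ (suc r ℕ./ e)) q (+ e) ⟩
      + (suc r ℕ.% e) + (q + + (suc r ℕ./ e)) * + e           ∎
      where open ≡-Reasoning

  %ℕ-as-shift : ∀ x → + (x %ℕ e) ≡ x + (- (x /ℕ e)) * + e
  %ℕ-as-shift x = trans (sym (cancel (+ (x %ℕ e)) (x /ℕ e) (+ e)))
                        (cong (_+ (- (x /ℕ e)) * + e) (sym (a≡a%ℕn+[a/ℕn]*n x e)))
    where
    cancel : ∀ r q E → r + q * E + (- q) * E ≡ r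
    cancel = solve-∀

  [1+r]%e-injective : ∀ {r r′} → r < e → r′ < e → suc r ℕ.% e ≡ suc r′ ℕ.% e → r ≡ r′
  [1+r]%e-injective {r} {r′} r<e r′<e eq with ℕP.m≤n⇒m<n∨m≡n r<e | ℕP.m≤n⇒m<n∨m≡n r′<e
  ... | inj₁ 1+r<e | inj₁ 1+r′<e =
    ℕP.suc-injective (trans (sym (ℕD.m<n⇒m%n≡m 1+r<e)) (trans eq (ℕD.m<n⇒m%n≡m 1+r′<e)))
  ... | inj₂ 1+r≡e | inj₂ 1+r′≡e = ℕP.suc-injective (trans 1+r≡e (sym 1+r′≡e))
  ... | inj₁ 1+r<e | inj₂ refl with trans (sym (ℕD.m<n⇒m%n≡m 1+r<e)) (trans eq (ℕD.n%n≡0 e))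
  ...   | ()
  [1+r]%e-injective r<e r′<e eq | inj₂ refl | inj₁ 1+r′<e
    with trans (sym (ℕD.m<n⇒m%n≡m 1+r′<e)) (trans (sym eq) (ℕD.n%n≡0 e))
  ...   | ()

-- Finite sums

∑< : ℕ → (ℕ → ℕ) → ℕ
∑< zero    f = 0
∑< (suc n) f = ∑< n f ℕ.+ f n

syntax ∑< n (λ j → t) = ∑[ j < n ] t

∑-cong : ∀ n {f g} → (∀ j → j < n → f j ≡ g j) → ∑< n f ≡ ∑< n g
∑-cong zero    f≗g = refl
∑-cong (suc n) f≗g = cong₂ ℕ._+_ (∑-cong n (λ j j<n → f≗g j (ℕP.m<n⇒m<1+n j<n))) (f≗g n ℕP.≤-refl)

∑-zero : ∀ n → ∑[ j < n ] 0 ≡ 0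
∑-zero zero    = refl
∑-zero (suc n) = trans (ℕP.+-identityʳ _) (∑-zero n)

∑-exchange : ∀ n {f g j₀} → j₀ < n → (∀ j → j < n → j ≢ j₀ → f j ≡ g j) →
             ∑< n f ℕ.+ g j₀ ≡ ∑< n g ℕ.+ f j₀
∑-exchange (suc n) {f} {g} {j₀} j₀<1+n f≗g with j₀ ℕ.≟ n
... | yes refl = begin
  ∑< n f ℕ.+ f n ℕ.+ g n  ≡⟨ xy∙z≈xz∙y (∑< n f) (f n) (g n) ⟩
  ∑< n f ℕ.+ g n ℕ.+ f n  ≡⟨ cong (λ t → t ℕ.+ g n ℕ.+ f n) (∑-cong n (λ j j<n → f≗g j (ℕP.m<n⇒m<1+n j<n) (ℕP.<⇒≢ j<n))) ⟩
  ∑< n g ℕ.+ g n ℕ.+ f n  ∎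
  where open ≡-Reasoning
... | no j₀≢n = begin
  ∑< n f ℕ.+ f n ℕ.+ g j₀  ≡⟨ xy∙z≈xz∙y (∑< n f) (f n) (g j₀) ⟩
  ∑< n f ℕ.+ g j₀ ℕ.+ f n  ≡⟨ cong₂ ℕ._+_ (∑-exchange n (ℕP.≤∧≢⇒< (ℕP.≤-pred j₀<1+n) j₀≢n)
                                       (λ j j<n → f≗g j (ℕP.m<n⇒m<1+n j<n)))
                                    (f≗g n ℕP.≤-refl (j₀≢n ∘ sym)) ⟩
  ∑< n g ℕ.+ f j₀ ℕ.+ g n  ≡⟨ xy∙z≈xz∙y (∑< n g) (f j₀) (g n) ⟩
  ∑< n g ℕ.+ g n ℕ.+ f j₀  ∎
  where open ≡-Reasoning

∑≡0⇒≡0 : ∀ n {f j} → ∑< n f ≡ 0 → j < n → f j ≡ 0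
∑≡0⇒≡0 (suc n) {f} {j} sum≡0 j<1+n with j ℕ.≟ n
... | yes refl = ℕP.m+n≡0⇒n≡0 (∑< n f) sum≡0
... | no j≢n   = ∑≡0⇒≡0 n (ℕP.m+n≡0⇒m≡0 (∑< n f) sum≡0) (ℕP.≤∧≢⇒< (ℕP.≤-pred j<1+n) j≢n)

∑≢0⇒∃≢0 : ∀ n {f} → ∑< n f ≢ 0 → ∃[ j ] (j < n × f j ≢ 0)
∑≢0⇒∃≢0 zero    sum≢0 = contradiction refl sum≢0
∑≢0⇒∃≢0 (suc n) {f} sum≢0 with f n ℕ.≟ 0
... | no fn≢0 = n , ℕP.≤-refl , fn≢0
... | yes fn≡0 with ∑≢0⇒∃≢0 n (λ sum≡0 → sum≢0 (cong₂ ℕ._+_ sum≡0 fn≡0))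
...   | j , j<n , fj≢0 = j , ℕP.m<n⇒m<1+n j<n , fj≢0

∑∑-exchange : ∀ m n {F G : ℕ → ℕ → ℕ} {a₀ d₀} → a₀ < m → d₀ < n →
              (∀ a d → a < m → d < n → a ≢ a₀ ⊎ d ≢ d₀ → F a d ≡ G a d) →
              ∑[ a < m ] ∑< n (F a) ℕ.+ G a₀ d₀ ≡ ∑[ a < m ] ∑< n (G a) ℕ.+ F a₀ d₀
∑∑-exchange m n {F} {G} {a₀} {d₀} a₀<m d₀<n F≗G = ℕP.+-cancelʳ-≡ (∑< n (G a₀)) (∑F ℕ.+ G a₀ d₀) (∑G ℕ.+ F a₀ d₀) (begin
  ∑F ℕ.+ G a₀ d₀ ℕ.+ ∑< n (G a₀)       ≡⟨ xy∙z≈xz∙y ∑F (G a₀ d₀) (∑< n (G a₀)) ⟩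
  ∑F ℕ.+ ∑< n (G a₀) ℕ.+ G a₀ d₀       ≡⟨ cong (ℕ._+ G a₀ d₀) rows ⟩
  ∑G ℕ.+ ∑< n (F a₀) ℕ.+ G a₀ d₀       ≡⟨ ℕP.+-assoc ∑G (∑< n (F a₀)) (G a₀ d₀) ⟩
  ∑G ℕ.+ (∑< n (F a₀) ℕ.+ G a₀ d₀)     ≡⟨ cong (λ t → ∑G ℕ.+ t) row-a₀ ⟩
  ∑G ℕ.+ (∑< n (G a₀) ℕ.+ F a₀ d₀)     ≡⟨ cong (λ t → ∑G ℕ.+ t) (ℕP.+-comm (∑< n (G a₀)) (F a₀ d₀)) ⟩
  ∑G ℕ.+ (F a₀ d₀ ℕ.+ ∑< n (G a₀))     ≡⟨ ℕP.+-assoc ∑G (F a₀ d₀) (∑< n (G a₀)) ⟨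
  ∑G ℕ.+ F a₀ d₀ ℕ.+ ∑< n (G a₀)       ∎)
  where
  open ≡-Reasoning
  ∑F = ∑[ a < m ] ∑< n (F a)
  ∑G = ∑[ a < m ] ∑< n (G a)
  rows : ∑F ℕ.+ ∑< n (G a₀) ≡ ∑G ℕ.+ ∑< n (F a₀)
  rows = ∑-exchange m {λ a → ∑< n (F a)} {λ a → ∑< n (G a)} a₀<m (λ a a<m a≢a₀ → ∑-cong n (λ d d<n → F≗G a d a<m d<n (inj₁ a≢a₀)))
  row-a₀ : ∑< n (F a₀) ℕ.+ G a₀ d₀ ≡ ∑< n (G a₀) ℕ.+ F a₀ d₀
  row-a₀ = ∑-exchange n {F a₀} {G a₀} d₀<n (λ d d<n d≢d₀ → F≗G a₀ d a₀<m d<n (inj₂ d≢d₀))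

∑ℤ< : ℕ → (ℕ → ℤ) → ℤ
∑ℤ< zero    f = 0ℤ
∑ℤ< (suc n) f = ∑ℤ< n f ℤ.+ f n

syntax ∑ℤ< n (λ j → t) = ∑ℤ[ j < n ] t

∑ℤ-cong : ∀ n {f g} → (∀ j → j < n → f j ≡ g j) → ∑ℤ< n f ≡ ∑ℤ< n g
∑ℤ-cong zero    f≗g = refl
∑ℤ-cong (suc n) f≗g = cong₂ ℤ._+_ (∑ℤ-cong n (λ j j<n → f≗g j (ℕP.m<n⇒m<1+n j<n))) (f≗g n ℕP.≤-refl)

∑ℤ-distrib-+ : ∀ n (f g : ℕ → ℤ) → ∑ℤ[ j < n ] (f j ℤ.+ g j) ≡ ∑ℤ< n f ℤ.+ ∑ℤ< n g
∑ℤ-distrib-+ zero    f g = refl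
∑ℤ-distrib-+ (suc n) f g = trans (cong (ℤ._+ (f n ℤ.+ g n)) (∑ℤ-distrib-+ n f g))
                                 (+-interchange (∑ℤ< n f) (∑ℤ< n g) (f n) (g n))

∑ℤ-const : ∀ n c → ∑ℤ[ j < n ] c ≡ + n ℤ.* c
∑ℤ-const zero    c = sym (ℤP.*-zeroˡ c)
∑ℤ-const (suc n) c = begin
  ∑ℤ[ j < n ] c ℤ.+ c     ≡⟨ cong (ℤ._+ c) (∑ℤ-const n c) ⟩
  + n ℤ.* c ℤ.+ c         ≡⟨ cong (λ t → + n ℤ.* c ℤ.+ t) (ℤP.*-identityˡ c) ⟨
  + n ℤ.* c ℤ.+ 1ℤ ℤ.* c  ≡⟨ ℤP.*-distribʳ-+ c (+ n) 1ℤ ⟨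
  (+ n ℤ.+ 1ℤ) ℤ.* c      ≡⟨ cong (ℤ._* c) (ℤP.+-comm (+ n) 1ℤ) ⟩
  + suc n ℤ.* c           ∎
  where open ≡-Reasoning

∑ℤ-+ : ∀ n (f : ℕ → ℕ) → ∑ℤ[ j < n ] (+ f j) ≡ + ∑< n f
∑ℤ-+ zero    f = refl
∑ℤ-+ (suc n) f = trans (cong (ℤ._+ + f n) (∑ℤ-+ n f)) (sym (ℤP.pos-+ (∑< n f) (f n)))

𝟙 : ∀ {P : Set} → Dec P → ℕ
𝟙 (yes _) = 1
𝟙 (no _)  = 0

𝟙-yes : ∀ {P : Set} (P? : Dec P) → P → 𝟙 P? ≡ 1
𝟙-yes (yes _) p  = refl
𝟙-yes (no ¬p) p = contradiction p ¬p

𝟙-no : ∀ {P : Set} (P? : Dec P) → ¬ P → 𝟙 P? ≡ 0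
𝟙-no (yes p) ¬p = contradiction p ¬p
𝟙-no (no _) ¬p  = refl

𝟙≢0⇒ : ∀ {P : Set} (P? : Dec P) → 𝟙 P? ≢ 0 → P
𝟙≢0⇒ (yes p) _  = p
𝟙≢0⇒ (no _) 1≢0 = contradiction refl 1≢0

𝟙≤1 : ∀ {P : Set} (P? : Dec P) → 𝟙 P? ≤ 1
𝟙≤1 (yes _) = ℕP.≤-refl
𝟙≤1 (no _)  = z≤n

if-yes : ∀ {P A : Set} (P? : Dec P) {a b : A} → P → (if ⌊ P? ⌋ then a else b) ≡ a
if-yes (yes _) p  = refl
if-yes (no ¬p) p = contradiction p ¬p

if-no : ∀ {P A : Set} (P? : Dec P) {a b : A} → ¬ P → (if ⌊ P? ⌋ then a else b) ≡ b
if-no (yes p) ¬p = contradiction p ¬p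
if-no (no _) ¬p  = refl

length-comparison : ∀ {A R : Set} {n m} → (A → m ≡ suc n) → (R → suc m ≡ n) → A ⊎ R →
                    (m < n ⇔ R) × (n < m ⇔ A)
length-comparison {n = n} {m} up down A⊎R =
  mk⇔ (λ m<n → [ (λ a → contradiction (subst (_< n) (up a) m<n) (ℕP.<-asym (ℕP.n<1+n n))) , id ]′ A⊎R)
      (ℕP.≤-reflexive ∘ down) ,
  mk⇔ (λ n<m → [ id , (λ r → contradiction (subst (_< m) (sym (down r)) n<m) (ℕP.<-asym (ℕP.n<1+n m))) ]′ A⊎R)
      (ℕP.≤-reflexive ∘ sym ∘ up)

-- Young diagrams

part-mono : ∀ {xs} → IsPartition xs → ∀ k → part xs (suc (suc k)) ≤ part xs (suc k)
part-mono {[]}         _                        k       = z≤n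
part-mono {x ∷ []}     _                        k       = z≤n
part-mono {x ∷ y ∷ xs} (_ , y≤x ∷ _)            zero    = y≤x
part-mono {x ∷ y ∷ xs} ((_ ∷ pos) , (_ ∷ desc)) (suc k) = part-mono {y ∷ xs} (pos , desc) k

part-beyond : ∀ xs {k} → length xs ≤ k → part xs (suc k) ≡ 0
part-beyond []       _         = refl
part-beyond (x ∷ xs) (s≤s len≤k) = part-beyond xs len≤k

isPartition : ∀ {ys} → All (0 <_) ys → (∀ k → part ys (suc (suc k)) ≤ part ys (suc k)) → IsPartition ys
isPartition {ys} pos mono = pos , descending ys mono
  where
  descending : ∀ ys → (∀ k → part ys (suc (suc k)) ≤ part ys (suc k)) → Linked ℕ._≥_ ys
  descending []           _    = []
  descending (y ∷ [])     _    = [-]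
  descending (y ∷ y′ ∷ ys) mono = mono 0 ∷ descending (y′ ∷ ys) (mono ∘ suc)

-- Rows are indexed from 0: row j has length part xs (suc j).  addBox xs j
-- appends a box to row j (meaningful for j ≤ length xs); removeBox xs j deletes
-- the last box of row j, and the row itself if that box was its only one.

addBox : List ℕ → ℕ → List ℕ
addBox []       _       = 1 ∷ []
addBox (x ∷ xs) zero    = suc x ∷ xs
addBox (x ∷ xs) (suc j) = x ∷ addBox xs j

addBox-positive : ∀ xs j → All (0 <_) xs → All (0 <_) (addBox xs j)
addBox-positive []       _       _          = s≤s z≤n ∷ []
addBox-positive (x ∷ xs) zero    (_ ∷ pos)  = s≤s z≤n ∷ pos
addBox-positive (x ∷ xs) (suc j) (px ∷ pos) = px ∷ addBox-positive xs j pos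

part-addBox-≡ : ∀ xs {j} → j ≤ length xs → part (addBox xs j) (suc j) ≡ suc (part xs (suc j))
part-addBox-≡ []       {zero}  _         = refl
part-addBox-≡ (x ∷ xs) {zero}  _         = refl
part-addBox-≡ (x ∷ xs) {suc j} (s≤s j≤n) = part-addBox-≡ xs j≤n

part-addBox-≢ : ∀ xs {j} k → j ≤ length xs → k ≢ j → part (addBox xs j) (suc k) ≡ part xs (suc k)
part-addBox-≢ []       {zero}  zero    _         0≢0 = contradiction refl 0≢0
part-addBox-≢ []       {zero}  (suc k) _         _   = refl
part-addBox-≢ (x ∷ xs) {zero}  zero    _         0≢0 = contradiction refl 0≢0
part-addBox-≢ (x ∷ xs) {zero}  (suc k) _         _   = refl
part-addBox-≢ (x ∷ xs) {suc j} zero    _         _   = refl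
part-addBox-≢ (x ∷ xs) {suc j} (suc k) (s≤s j≤n) k≢j = part-addBox-≢ xs k j≤n (k≢j ∘ cong suc)

removeBox : List ℕ → ℕ → List ℕ
removeBox []       _       = []
removeBox (x ∷ xs) zero    = shrink x
  where
  shrink : ℕ → List ℕ
  shrink (suc (suc y)) = suc y ∷ xs
  shrink _             = xs
removeBox (x ∷ xs) (suc j) = x ∷ removeBox xs j

removeBox-positive : ∀ xs j → All (0 <_) xs → All (0 <_) (removeBox xs j)
removeBox-positive []                 _       _          = []
removeBox-positive (zero ∷ xs)        zero    (_ ∷ pos)  = pos
removeBox-positive (suc zero ∷ xs)    zero    (_ ∷ pos)  = pos
removeBox-positive (suc (suc x) ∷ xs) zero    (_ ∷ pos)  = s≤s z≤n ∷ pos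
removeBox-positive (x ∷ xs)           (suc j) (px ∷ pos) = px ∷ removeBox-positive xs j pos

part-removeBox : ∀ xs {j} → IsPartition xs → part xs (suc (suc j)) < part xs (suc j) →
                 part (removeBox xs j) (suc j) ≡ ℕ.pred (part xs (suc j)) ×
                 (∀ k → k ≢ j → part (removeBox xs j) (suc k) ≡ part xs (suc k))
part-removeBox (zero ∷ xs)            {zero}  _ ()
part-removeBox (suc zero ∷ [])        {zero}  _ _ = refl , λ { zero 0≢0 → contradiction refl 0≢0 ; (suc k) _ → refl }
part-removeBox (suc zero ∷ y ∷ xs)    {zero}  ((_ ∷ 0<y ∷ _) , _) y<1 =
  contradiction (ℕP.<-≤-trans y<1 0<y) (ℕP.<-irrefl refl)
part-removeBox (suc (suc x) ∷ xs)     {zero}  _ _ = refl , λ { zero 0≢0 → contradiction refl 0≢0 ; (suc k) _ → refl }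
part-removeBox (x ∷ xs)               {suc j} ((_ ∷ pos) , desc) shorter
  with part-removeBox xs {j} (pos , Linked.tail desc) shorter
... | here , elsewhere = here , λ { zero _ → refl ; (suc k) k≢j → elsewhere k (k≢j ∘ cong suc) }

InY-grow : ∀ {xs ys j} → part ys (suc j) ≡ suc (part xs (suc j)) →
           (∀ k → k ≢ j → part ys (suc k) ≡ part xs (suc k)) →
           ∀ δ → InY ys δ ⇔ (InY xs δ ⊎ δ ≡ (suc j , suc (part xs (suc j))))
InY-grow here elsewhere (zero , b) = mk⇔ (λ { (() , _) }) (λ { (inj₁ (() , _)) ; (inj₂ ()) })
InY-grow {xs} {ys} {j} here elsewhere (suc a , b) with a ℕ.≟ j
... | yes refl = mk⇔ to from
  where
  to : InY ys (suc a , b) → InY xs (suc a , b) ⊎ (suc a , b) ≡ (suc a , suc (part xs (suc a)))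
  to (1≤a , 1≤b , b≤) with b ℕ.≤? part xs (suc a)
  ... | yes b≤λ = inj₁ (1≤a , 1≤b , b≤λ)
  ... | no b≰λ  = inj₂ (cong (suc a ,_) (ℕP.≤-antisym (subst (b ≤_) here b≤) (ℕP.≰⇒> b≰λ)))
  from : InY xs (suc a , b) ⊎ (suc a , b) ≡ (suc a , suc (part xs (suc a))) → InY ys (suc a , b)
  from (inj₁ (1≤a , 1≤b , b≤λ)) = 1≤a , 1≤b , subst (b ≤_) (sym here) (ℕP.m≤n⇒m≤1+n b≤λ)
  from (inj₂ refl)              = s≤s z≤n , s≤s z≤n , ℕP.≤-reflexive (sym here)
... | no a≢j = mk⇔
  (λ (1≤a , 1≤b , b≤) → inj₁ (1≤a , 1≤b , subst (b ≤_) (elsewhere a a≢j) b≤))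
  (λ { (inj₁ (1≤a , 1≤b , b≤)) → 1≤a , 1≤b , subst (b ≤_) (sym (elsewhere a a≢j)) b≤
     ; (inj₂ eq) → contradiction (ℕP.suc-injective (cong proj₁ eq)) a≢j })

InY-shrink : ∀ {xs ys j} → 1 ≤ part xs (suc j) → part ys (suc j) ≡ ℕ.pred (part xs (suc j)) →
             (∀ k → k ≢ j → part ys (suc k) ≡ part xs (suc k)) →
             ∀ δ → InY ys δ ⇔ (InY xs δ × δ ≢ (suc j , part xs (suc j)))
InY-shrink 1≤λ here elsewhere (zero , b) = mk⇔ (λ { (() , _) }) (λ { ((() , _) , _) })
InY-shrink {xs} {ys} {j} 1≤λ here elsewhere (suc a , b) with a ℕ.≟ j
... | yes refl = mk⇔ to from
  where
  to : InY ys (suc a , b) → InY xs (suc a , b) × (suc a , b) ≢ (suc a , part xs (suc a))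
  to (1≤a , 1≤b , b≤) = (1≤a , 1≤b , ℕP.≤-trans b≤pred ℕP.pred[n]≤n) ,
                        λ eq → ℕP.<-irrefl refl (ℕP.m≤pred[n]⇒suc[m]≤n {{ℕ.>-nonZero 1≤λ}}
                                                  (subst (_≤ ℕ.pred (part xs (suc a))) (cong proj₂ eq) b≤pred))
    where
    b≤pred : b ≤ ℕ.pred (part xs (suc a))
    b≤pred = subst (b ≤_) here b≤
  from : InY xs (suc a , b) × (suc a , b) ≢ (suc a , part xs (suc a)) → InY ys (suc a , b)
  from ((1≤a , 1≤b , b≤λ) , b≢λ) =
    1≤a , 1≤b , subst (b ≤_) (sym here) (ℕP.<⇒≤pred (ℕP.≤∧≢⇒< b≤λ (b≢λ ∘ cong (suc a ,_))))
... | no a≢j = mk⇔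
  (λ (1≤a , 1≤b , b≤) → (1≤a , 1≤b , subst (b ≤_) (elsewhere a a≢j) b≤) ,
                         a≢j ∘ ℕP.suc-injective ∘ cong proj₁)
  (λ ((1≤a , 1≤b , b≤) , _) → 1≤a , 1≤b , subst (b ≤_) (sym (elsewhere a a≢j)) b≤)

RowCanGrow : List ℕ → ℕ → Set
RowCanGrow xs j = ∀ {j′} → j ≡ suc j′ → part xs (suc j) < part xs j

RowCanGrow⇒≤length : ∀ xs {j} → RowCanGrow xs j → j ≤ length xs
RowCanGrow⇒≤length xs {zero}  _    = z≤n
RowCanGrow⇒≤length xs {suc j} grow with length xs ℕ.≤? j
... | yes len≤j = contradiction (subst (part xs (suc (suc j)) <_) (part-beyond xs len≤j) (grow refl)) λ ()
... | no len≰j  = ℕP.≰⇒> len≰j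

addable-row : ∀ {xs j} → IsPartition xs → RowCanGrow xs j → Addable xs (suc j , suc (part xs (suc j)))
addable-row {xs} {j} (pos , desc) grow =
  (λ (_ , _ , 1+λ≤λ) → ℕP.<-irrefl refl 1+λ≤λ) ,
  addBox xs j , isPartition (addBox-positive xs j pos) mono , InY-grow {xs} {addBox xs j} here elsewhere
  where
  j≤len = RowCanGrow⇒≤length xs grow
  here = part-addBox-≡ xs j≤len
  elsewhere = λ k k≢j → part-addBox-≢ xs k j≤len k≢j
  mono : ∀ k → part (addBox xs j) (suc (suc k)) ≤ part (addBox xs j) (suc k)
  mono k with k ℕ.≟ j | suc k ℕ.≟ j
  ... | yes refl | _ = subst₂ _≤_ (sym (elsewhere (suc k) (ℕP.<⇒≢ (ℕP.n<1+n k) ∘ sym))) (sym here)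
                                   (ℕP.m≤n⇒m≤1+n (part-mono (pos , desc) k))
  ... | no k≢j | yes refl = subst₂ _≤_ (sym here) (sym (elsewhere k k≢j)) (grow refl)
  ... | no k≢j | no 1+k≢j = subst₂ _≤_ (sym (elsewhere (suc k) 1+k≢j)) (sym (elsewhere k k≢j))
                                        (part-mono (pos , desc) k)

removable-row : ∀ {xs j} → IsPartition xs → part xs (suc (suc j)) < part xs (suc j) →
                Removable xs (suc j , part xs (suc j))
removable-row {xs} {j} (pos , desc) shorter =
  (s≤s z≤n , 1≤λ , ℕP.≤-refl) ,
  removeBox xs j , isPartition (removeBox-positive xs j pos) mono , InY-shrink {xs} {removeBox xs j} 1≤λ here elsewhere
  where
  1≤λ = ℕP.<-≤-trans (s≤s z≤n) shorter
  here = proj₁ (part-removeBox xs (pos , desc) shorter)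
  elsewhere = proj₂ (part-removeBox xs (pos , desc) shorter)
  mono : ∀ k → part (removeBox xs j) (suc (suc k)) ≤ part (removeBox xs j) (suc k)
  mono k with k ℕ.≟ j | suc k ℕ.≟ j
  ... | yes refl | _ = subst₂ _≤_ (sym (elsewhere (suc k) (ℕP.<⇒≢ (ℕP.n<1+n k) ∘ sym))) (sym here) (ℕP.<⇒≤pred shorter)
  ... | no k≢j | yes refl = subst₂ _≤_ (sym here) (sym (elsewhere k k≢j))
                                        (ℕP.≤-trans ℕP.pred[n]≤n (part-mono (pos , desc) k))
  ... | no k≢j | no 1+k≢j = subst₂ _≤_ (sym (elsewhere (suc k) 1+k≢j)) (sym (elsewhere k k≢j))
                                        (part-mono (pos , desc) k)

row-grows : ∀ {xs ys j b} → IsPartition ys → (∀ δ → InY ys δ ⇔ (InY xs δ ⊎ δ ≡ (suc j , b))) →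
            1 ≤ b → b ≤ part ys (suc j) → b ≡ suc (part xs (suc j)) → RowCanGrow xs j
row-grows {xs} {j = suc j′} {b} ys-partition ys≡xs+γ 1≤b b≤ys b≡1+row refl
  with Equivalence.to (ys≡xs+γ (suc j′ , b)) (s≤s z≤n , 1≤b , ℕP.≤-trans b≤ys (part-mono ys-partition j′))
... | inj₁ (_ , _ , b≤row′) = subst (_≤ part xs (suc j′)) b≡1+row b≤row′
... | inj₂ eq               = contradiction (ℕP.suc-injective (cong proj₁ eq)) (ℕP.<⇒≢ (ℕP.n<1+n j′))

addable-shape : ∀ {xs γ} → Addable xs γ → ∃[ j ] (γ ≡ (suc j , suc (part xs (suc j))) × RowCanGrow xs j)
addable-shape {xs} {a , b} (γ∉xs , ys , ys-partition , ys≡xs+γ)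
  with Equivalence.from (ys≡xs+γ (a , b)) (inj₂ refl)
... | s≤s {n = j} z≤n , 1≤b , b≤ys = j , cong (suc j ,_) b≡1+row ,
      row-grows {xs} ys-partition ys≡xs+γ 1≤b b≤ys b≡1+row
  where
  row = part xs (suc j)
  row<b : row < b
  row<b = ℕP.≰⇒> (λ b≤λ → γ∉xs (s≤s z≤n , 1≤b , b≤λ))
  b≤1+row : b ≤ suc row
  b≤1+row = ℕP.≮⇒≥ λ 1+row<b → case Equivalence.to (ys≡xs+γ (suc j , suc row))
                                   (s≤s z≤n , s≤s z≤n , ℕP.≤-trans (ℕP.<⇒≤ 1+row<b) b≤ys) of λ where
    (inj₁ (_ , _ , 1+row≤row)) → ℕP.<-irrefl refl 1+row≤row
    (inj₂ eq)                  → ℕP.<⇒≢ 1+row<b (cong proj₂ eq)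
  b≡1+row : b ≡ suc row
  b≡1+row = ℕP.≤-antisym b≤1+row row<b

removable-shape : ∀ {xs γ} → Removable xs γ →
                  ∃[ j ] (γ ≡ (suc j , part xs (suc j)) × part xs (suc (suc j)) < part xs (suc j))
removable-shape {xs} {a , b} ((s≤s {n = j} z≤n , 1≤b , b≤λ) , ys , ys-partition , ys≡xs-γ) =
  j , cong (suc j ,_) b≡λ , next-row-shorter
  where
  γ∉ys : ¬ InY ys (suc j , b)
  γ∉ys γ∈ys = proj₂ (Equivalence.to (ys≡xs-γ (suc j , b)) γ∈ys) refl
  b≡λ : b ≡ part xs (suc j)
  b≡λ = ℕP.≤-antisym b≤λ (ℕP.≮⇒≥ λ b<λ → γ∉ys
    (let (_ , _ , 1+b≤ys) = Equivalence.from (ys≡xs-γ (suc j , suc b))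
                              ((s≤s z≤n , s≤s z≤n , b<λ) , ℕP.<⇒≢ (ℕP.n<1+n b) ∘ sym ∘ cong proj₂)
     in s≤s z≤n , 1≤b , ℕP.≤-trans (ℕP.n≤1+n b) 1+b≤ys))
  next-row-shorter : part xs (suc (suc j)) < part xs (suc j)
  next-row-shorter = subst (part xs (suc (suc j)) <_) b≡λ (ℕP.≰⇒> λ b≤λ′ → γ∉ys
    (let (_ , _ , b≤ys′) = Equivalence.from (ys≡xs-γ (suc (suc j) , b))
                             ((s≤s z≤n , 1≤b , b≤λ′) , ℕP.<⇒≢ (ℕP.n<1+n j) ∘ sym ∘ ℕP.suc-injective ∘ cong proj₁)
     in s≤s z≤n , 1≤b , ℕP.≤-trans b≤ys′ (part-mono ys-partition j)))

-- Abaci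

AddableEdge RemovableEdge : (ℤ → Set) → ℤ → Set
AddableEdge   S x = S x × ¬ S (x + 1ℤ)
RemovableEdge S x = ¬ S x × S (x + 1ℤ)

AddableEdge-⇔ : ∀ {S T x} → (∀ y → S y ⇔ T y) → AddableEdge S x → AddableEdge T x
AddableEdge-⇔ S⇔T (x∈S , x+1∉S) =
  Equivalence.to (S⇔T _) x∈S , x+1∉S ∘ Equivalence.from (S⇔T _)

RemovableEdge-⇔ : ∀ {S T x} → (∀ y → S y ⇔ T y) → RemovableEdge S x → RemovableEdge T x
RemovableEdge-⇔ S⇔T (x∉S , x+1∈S) =
  x∉S ∘ Equivalence.from (S⇔T _) , Equivalence.to (S⇔T _) x+1∈S

content : ℤ → Node → ℤ
content c (a , b) = + b - + a + c

module Beads (μ : ChargedPartition) where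

  private
    xs = parts μ
    c  = charge μ

  -- InAbacus μ x unfolds to ∃ k ≥ 1 with x ≡ bead k.
  bead : ℕ → ℤ
  bead k = + part xs k - + k + c + 1ℤ

  bead-gap : ∀ j → bead (suc j) - (bead (suc (suc j)) + 1ℤ) ≡ + part xs (suc j) - + part xs (suc (suc j))
  bead-gap j = simplify (+ part xs (suc j)) (+ part xs (suc (suc j))) (+ j) c
    where
    simplify : ∀ l l′ j c → l - (1ℤ + j) + c + 1ℤ - (l′ - (1ℤ + (1ℤ + j)) + c + 1ℤ + 1ℤ) ≡ l - l′
    simplify = solve-∀

  bead+1≤bead : ∀ j → bead (suc (suc j)) + 1ℤ ℤ.≤ bead (suc j)
  bead+1≤bead j = ≤-from-diff (ℤP.i≤j⇒0≤j-i (ℤ.+≤+ (part-mono (isPart μ) j))) (bead-gap j)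

  bead+1<bead : ∀ {j} → part xs (suc (suc j)) < part xs (suc j) → bead (suc (suc j)) + 1ℤ ℤ.< bead (suc j)
  bead+1<bead {j} shorter = <-from-diff (i<j⇒0≤j-i-1 (ℤ.+<+ shorter)) (cong (_- 1ℤ) (bead-gap j))

  bead+1≡bead : ∀ {j} → part xs (suc (suc j)) ≡ part xs (suc j) → bead (suc (suc j)) + 1ℤ ≡ bead (suc j)
  bead+1≡bead {j} same = sym (ℤP.i-j≡0⇒i≡j _ _ (trans (bead-gap j)
                           (trans (cong (λ l → l - + part xs (suc (suc j))) (cong +_ (sym same))) (ℤP.+-inverseʳ (+ part xs (suc (suc j)))))))

  bead-antitone : ∀ {k k′} → k ≤ k′ → bead (suc k′) ℤ.≤ bead (suc k)
  bead-antitone {k} {k′} k≤k′ = subst (λ m → bead (suc m) ℤ.≤ bead (suc k)) (ℕP.m∸n+n≡m k≤k′) (descend (k′ ℕ.∸ k))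
    where
    descend : ∀ n → bead (suc (n ℕ.+ k)) ℤ.≤ bead (suc k)
    descend zero    = ℤP.≤-refl
    descend (suc n) = ℤP.≤-trans (ℤP.<⇒≤ (ℤP.<-≤-trans (i<i+1 _) (bead+1≤bead (n ℕ.+ k)))) (descend n)

  no-bead-between : ∀ {j y} → bead (suc (suc j)) ℤ.< y → y ℤ.< bead (suc j) → ¬ InAbacus μ y
  no-bead-between {j} below above (zero , () , _)
  no-bead-between {j} below above (suc k , _ , refl) with k ℕ.≤? j
  ... | yes k≤j = ℤP.<⇒≱ above (bead-antitone k≤j)
  ... | no k≰j  = ℤP.<⇒≱ below (bead-antitone (ℕP.≰⇒> k≰j))

  no-bead-above : ∀ {y} → bead 1 ℤ.< y → ¬ InAbacus μ y
  no-bead-above above (zero , () , _)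
  no-bead-above above (suc k , _ , refl) = ℤP.<⇒≱ above (bead-antitone z≤n)

  content-addable : ∀ j → content c (suc j , suc (part xs (suc j))) ≡ bead (suc j)
  content-addable j = move-1 (+ part xs (suc j)) (+ suc j) c
    where
    move-1 : ∀ l a c → 1ℤ + l - a + c ≡ l - a + c + 1ℤ
    move-1 = solve-∀

  content-removable : ∀ j → content c (suc j , part xs (suc j)) + 1ℤ ≡ bead (suc j)
  content-removable j = refl

  addable⇒edge : ∀ {γ} → Addable xs γ → AddableEdge (InAbacus μ) (content c γ)
  addable⇒edge addable with addable-shape {xs} addable
  ... | j , refl , grow = (suc j , s≤s z≤n , content-addable j) ,
                          subst (λ x → ¬ InAbacus μ (x + 1ℤ)) (sym (content-addable j)) (next-free grow)
    where
    next-free : ∀ {j} → RowCanGrow xs j → ¬ InAbacus μ (bead (suc j) + 1ℤ)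
    next-free {zero}   _    = no-bead-above (i<i+1 (bead 1))
    next-free {suc j′} grow = no-bead-between (i<i+1 _) (bead+1<bead (grow refl))

  removable⇒edge : ∀ {γ} → Removable xs γ → RemovableEdge (InAbacus μ) (content c γ)
  removable⇒edge removable with removable-shape {xs} removable
  ... | j , refl , shorter =
    no-bead-between (+-cancelʳ-< 1ℤ (ℤP.<-≤-trans (bead+1<bead shorter) (ℤP.≤-reflexive (sym (content-removable j)))))
                    (ℤP.<-≤-trans (i<i+1 _) (ℤP.≤-reflexive (content-removable j))) ,
    (suc j , s≤s z≤n , content-removable j)

  edge⇒addable : ∀ {x} → AddableEdge (InAbacus μ) x → ∃[ γ ] (Addable xs γ × content c γ ≡ x)
  edge⇒addable ((zero , () , _) , _)
  edge⇒addable ((suc j , _ , refl) , next∉A) =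
    (suc j , suc (part xs (suc j))) , addable-row (isPart μ) (row-can-grow next∉A) , content-addable j
    where
    row-can-grow : ∀ {j} → ¬ InAbacus μ (bead (suc j) + 1ℤ) → RowCanGrow xs j
    row-can-grow {suc j′} next∉A refl =
      ℕP.≤∧≢⇒< (part-mono (isPart μ) j′) (λ same → next∉A (suc j′ , s≤s z≤n , bead+1≡bead same))

  edge⇒removable : ∀ {x} → RemovableEdge (InAbacus μ) x → ∃[ γ ] (Removable xs γ × content c γ ≡ x)
  edge⇒removable (x∉A , (zero , () , _))
  edge⇒removable {x} (x∉A , (suc j , _ , x+1≡bead)) =
    (suc j , part xs (suc j)) , removable-row (isPart μ) shorter ,
    +-cancelʳ 1ℤ _ _ (trans (content-removable j) (sym x+1≡bead))
    where
    shorter : part xs (suc (suc j)) < part xs (suc j)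
    shorter = ℕP.≤∧≢⇒< (part-mono (isPart μ) j) λ same →
      x∉A (suc (suc j) , s≤s z≤n , +-cancelʳ 1ℤ _ _ (trans x+1≡bead (sym (bead+1≡bead same))))

image-cong : ∀ {g g′ : ℤ → ℤ} → (∀ x → g x ≡ g′ x) →
             ∀ c y → ImageOfEmptyAbacus g c y ⇔ ImageOfEmptyAbacus g′ c y
image-cong g≗g′ c y = mk⇔ (λ (z , z≤c , gz≡y) → z , z≤c , trans (sym (g≗g′ z)) gz≡y)
                          (λ (z , z≤c , g′z≡y) → z , z≤c , trans (g≗g′ z) g′z≡y)

-- The affine symmetric group

module Affine (k : ℕ) where

  e : ℕ
  e = suc (suc k)

  open Residues e

  r≢[1+r]%e : ∀ {r} → r < e → r ≢ suc r ℕ.% e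
  r≢[1+r]%e {r} r<e eq with ℕP.m≤n⇒m<n∨m≡n r<e
  ... | inj₁ 1+r<e = ℕP.<⇒≢ (ℕP.n<1+n r) (trans eq (ℕD.m<n⇒m%n≡m 1+r<e))
  ... | inj₂ refl with trans eq (ℕD.n%n≡0 e)
  ...   | ()

  module Generator (i : Fin e) where

    ι ι′ : ℕ
    ι  = toℕ i
    ι′ = suc ι ℕ.% e

    ι≢ι′ : ι ≢ ι′
    ι≢ι′ = r≢[1+r]%e (FinP.toℕ<n i)

    s : ℤ → ℤ
    s = gen e i

    data Case (x : ℤ) : Set where
      raise : x %ℕ e ≡ ι  → s x ≡ x + 1ℤ → Case x
      lower : x %ℕ e ≡ ι′ → s x ≡ x - 1ℤ → Case x
      fixed : x %ℕ e ≢ ι → x %ℕ e ≢ ι′ → s x ≡ x → Case x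

    case : ∀ x → Case x
    case x with x %ℕ e ℕ.≟ ι | x %ℕ e ℕ.≟ ι′
    ... | yes x≡ι | _       = raise x≡ι (if-yes (x %ℕ e ℕ.≟ ι) x≡ι)
    ... | no x≢ι | yes x≡ι′ = lower x≡ι′ (trans (if-no (x %ℕ e ℕ.≟ ι) x≢ι) (if-yes (x %ℕ e ℕ.≟ ι′) x≡ι′))
    ... | no x≢ι | no x≢ι′  = fixed x≢ι x≢ι′ (trans (if-no (x %ℕ e ℕ.≟ ι) x≢ι) (if-no (x %ℕ e ℕ.≟ ι′) x≢ι′))

    s-raise : ∀ x → x %ℕ e ≡ ι → s x ≡ x + 1ℤ
    s-raise x x≡ι with case x
    ... | raise _ eq       = eq
    ... | lower x≡ι′ _     = contradiction (trans (sym x≡ι) x≡ι′) ι≢ι′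
    ... | fixed x≢ι _ _    = contradiction x≡ι x≢ι

    s-lower : ∀ x → x %ℕ e ≡ ι′ → s x ≡ x - 1ℤ
    s-lower x x≡ι′ with case x
    ... | raise x≡ι _      = contradiction (trans (sym x≡ι) x≡ι′) ι≢ι′
    ... | lower _ eq       = eq
    ... | fixed _ x≢ι′ _   = contradiction x≡ι′ x≢ι′

    s-fixed : ∀ x → x %ℕ e ≢ ι → x %ℕ e ≢ ι′ → s x ≡ x
    s-fixed x x≢ι x≢ι′ with case x
    ... | raise x≡ι _      = contradiction x≡ι x≢ι
    ... | lower x≡ι′ _     = contradiction x≡ι′ x≢ι′
    ... | fixed _ _ eq     = eq

    [x+1]%ℕe≡ι′ : ∀ x → x %ℕ e ≡ ι → (x + 1ℤ) %ℕ e ≡ ι′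
    [x+1]%ℕe≡ι′ x x≡ι = trans ([x+1]%ℕe≡[1+x%ℕe]%e x) (cong (λ r → suc r ℕ.% e) x≡ι)

    [x-1]%ℕe≡ι : ∀ x → x %ℕ e ≡ ι′ → (x - 1ℤ) %ℕ e ≡ ι
    [x-1]%ℕe≡ι x x≡ι′ = [1+r]%e-injective (n%ℕd<d (x - 1ℤ) e) (FinP.toℕ<n i)
      (trans (sym ([x+1]%ℕe≡[1+x%ℕe]%e (x - 1ℤ))) (trans (cong (_%ℕ e) (i-1+1≡i x)) x≡ι′))

    s-involutive : ∀ x → s (s x) ≡ x
    s-involutive x with case x
    ... | raise x≡ι eq  = trans (cong s eq) (trans (s-lower (x + 1ℤ) ([x+1]%ℕe≡ι′ x x≡ι)) (i+1-1≡i x))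
    ... | lower x≡ι′ eq = trans (cong s eq) (trans (s-raise (x - 1ℤ) ([x-1]%ℕe≡ι x x≡ι′)) (i-1+1≡i x))
    ... | fixed _ _ eq  = trans (cong s eq) eq

    s-injective : ∀ {x y} → s x ≡ s y → x ≡ y
    s-injective {x} {y} eq = trans (sym (s-involutive x)) (trans (cong s eq) (s-involutive y))

    s-periodic : ∀ x q → s (x + q * + e) ≡ s x + q * + e
    s-periodic x q with case x
    ... | raise x≡ι eq  = trans (s-raise (x + q * + e) (trans ([x+qe]%ℕe≡x%ℕe x q) x≡ι))
                                (trans (xy+z≡xz+y x (q * + e) 1ℤ) (cong (_+ q * + e) (sym eq)))
    ... | lower x≡ι′ eq = trans (s-lower (x + q * + e) (trans ([x+qe]%ℕe≡x%ℕe x q) x≡ι′))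
                                (trans (xy+z≡xz+y x (q * + e) (- 1ℤ)) (cong (_+ q * + e) (sym eq)))
    ... | fixed x≢ι x≢ι′ eq =
      trans (s-fixed (x + q * + e) (x≢ι ∘ trans (sym ([x+qe]%ℕe≡x%ℕe x q)))
                       (x≢ι′ ∘ trans (sym ([x+qe]%ℕe≡x%ℕe x q))))
            (cong (_+ q * + e) (sym eq))

    s≤i+1 : ∀ x → s x ℤ.≤ x + 1ℤ
    s≤i+1 x with case x
    ... | raise _ eq   = ℤP.≤-reflexive eq
    ... | lower _ eq   = ℤP.≤-trans (ℤP.≤-reflexive eq) (ℤP.<⇒≤ (ℤP.<-trans (i-1<i x) (i<i+1 x)))
    ... | fixed _ _ eq = ℤP.≤-trans (ℤP.≤-reflexive eq) (ℤP.<⇒≤ (i<i+1 x))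

    i≤s+1 : ∀ x → x ℤ.≤ s x + 1ℤ
    i≤s+1 x with case x
    ... | raise _ eq   = ℤP.≤-trans (ℤP.<⇒≤ (ℤP.<-trans (i<i+1 x) (i<i+1 (x + 1ℤ)))) (ℤP.≤-reflexive (cong (_+ 1ℤ) (sym eq)))
    ... | lower _ eq   = ℤP.≤-reflexive (trans (sym (i-1+1≡i x)) (cong (_+ 1ℤ) (sym eq)))
    ... | fixed _ _ eq = ℤP.≤-trans (ℤP.<⇒≤ (i<i+1 x)) (ℤP.≤-reflexive (cong (_+ 1ℤ) (sym eq)))

    s-monotone : ∀ {y x} → y ℤ.< x → ¬ (y %ℕ e ≡ ι × x ≡ y + 1ℤ) → s y ℤ.< s x
    s-monotone {y} {x} y<x not-swapped with x ℤP.≤? y + 1ℤ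
    ... | no x≰y+1 = ℤP.≤∧≢⇒< s[y]≤s[x] (λ eq → ℤP.<⇒≢ y<x (s-injective eq))
      where
      split : ∀ sx sy x y → sx - sy ≡ (sx + 1ℤ - x) + (x - (y + 1ℤ) - 1ℤ) + (y + 1ℤ - sy)
      split = solve-∀
      s[y]≤s[x] : s y ℤ.≤ s x
      s[y]≤s[x] = ≤-from-diff (ℤP.+-mono-≤ (ℤP.+-mono-≤ (ℤP.i≤j⇒0≤j-i (i≤s+1 x)) (i<j⇒0≤j-i-1 (ℤP.≰⇒> x≰y+1)))
                                          (ℤP.i≤j⇒0≤j-i (s≤i+1 y)))
                              (split (s x) (s y) x y)
    ... | yes x≤y+1 with ℤP.≤-antisym x≤y+1 (subst (ℤ._≤ x) (ℤP.+-comm 1ℤ y) (ℤP.i<j⇒suc[i]≤j y<x))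
    ...   | refl with case y
    ...     | raise y≡ι _ = contradiction (y≡ι , refl) not-swapped
    ...     | lower _ eq  = subst (ℤ._< s (y + 1ℤ)) (sym eq)
                              (<-from-diff (ℤP.i≤j⇒0≤j-i (i≤s+1 (y + 1ℤ))) (simplify (s (y + 1ℤ)) y))
      where
      simplify : ∀ z y → z - (y - 1ℤ) - 1ℤ ≡ z + 1ℤ - (y + 1ℤ)
      simplify = solve-∀
    ...     | fixed y≢ι _ eq with case (y + 1ℤ)
    ...       | raise _ eq′ = subst₂ ℤ._<_ (sym eq) (sym eq′) (ℤP.<-trans (i<i+1 y) (i<i+1 (y + 1ℤ)))
    ...       | lower y+1≡ι′ _ = contradiction ([1+r]%e-injective (n%ℕd<d y e) (FinP.toℕ<n i)
                                   (trans (sym ([x+1]%ℕe≡[1+x%ℕe]%e y)) y+1≡ι′)) y≢ι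
    ...       | fixed _ _ eq′ = subst₂ ℤ._<_ (sym eq) (sym eq′) (i<i+1 y)

    flip⇒adjacent : ∀ {y x} → y ℤ.< x → s x ℤ.< s y → y %ℕ e ≡ ι × x ≡ y + 1ℤ
    flip⇒adjacent {y} {x} y<x sx<sy with (y %ℕ e ℕ.≟ ι) ×-dec (x ℤ.≟ y + 1ℤ)
    ... | yes adjacent = adjacent
    ... | no ¬adjacent = contradiction sx<sy (ℤP.<-asym (s-monotone y<x ¬adjacent))

    s-displacement : ∀ y → s y - y + + 𝟙 (y %ℕ e ℕ.≟ ι′) ≡ + 𝟙 (y %ℕ e ℕ.≟ ι)
    s-displacement y with case y
    ... | raise y≡ι eq = begin
      s y - y + + 𝟙 (y %ℕ e ℕ.≟ ι′)  ≡⟨ cong₂ (λ u v → u - y + + v) eq (𝟙-no (_ ℕ.≟ ι′) (ι≢ι′ ∘ trans (sym y≡ι))) ⟩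
      y + 1ℤ - y + 0ℤ                ≡⟨ simplify y ⟩
      1ℤ                             ≡⟨ cong +_ (𝟙-yes (_ ℕ.≟ ι) y≡ι) ⟨
      + 𝟙 (y %ℕ e ℕ.≟ ι)             ∎
      where
      open ≡-Reasoning
      simplify : ∀ y → y + 1ℤ - y + 0ℤ ≡ 1ℤ
      simplify = solve-∀
    ... | lower y≡ι′ eq = begin
      s y - y + + 𝟙 (y %ℕ e ℕ.≟ ι′)  ≡⟨ cong₂ (λ u v → u - y + + v) eq (𝟙-yes (_ ℕ.≟ ι′) y≡ι′) ⟩
      y - 1ℤ - y + 1ℤ                ≡⟨ simplify y ⟩
      0ℤ                             ≡⟨ cong +_ (𝟙-no (_ ℕ.≟ ι) (λ y≡ι → ι≢ι′ (trans (sym y≡ι) y≡ι′))) ⟨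
      + 𝟙 (y %ℕ e ℕ.≟ ι)             ∎
      where
      open ≡-Reasoning
      simplify : ∀ y → y - 1ℤ - y + 1ℤ ≡ 0ℤ
      simplify = solve-∀
    ... | fixed y≢ι y≢ι′ eq = begin
      s y - y + + 𝟙 (y %ℕ e ℕ.≟ ι′)  ≡⟨ cong₂ (λ u v → u - y + + v) eq (𝟙-no (_ ℕ.≟ ι′) y≢ι′) ⟩
      y - y + 0ℤ                     ≡⟨ simplify y ⟩
      0ℤ                             ≡⟨ cong +_ (𝟙-no (_ ℕ.≟ ι) y≢ι) ⟨
      + 𝟙 (y %ℕ e ℕ.≟ ι)             ∎
      where
      open ≡-Reasoning
      simplify : ∀ y → y - y + 0ℤ ≡ 0ℤ
      simplify = solve-∀

  ⟦_⟧ : List (Fin e) → ℤ → ℤ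
  ⟦ ws ⟧ = evalWord e ws

  ⟦_⟧⁻¹ : List (Fin e) → ℤ → ℤ
  ⟦ [] ⟧⁻¹     = id
  ⟦ i ∷ ws ⟧⁻¹ = ⟦ ws ⟧⁻¹ ∘ gen e i

  ⟦⟧⁻¹-inverseˡ : ∀ ws x → ⟦ ws ⟧⁻¹ (⟦ ws ⟧ x) ≡ x
  ⟦⟧⁻¹-inverseˡ []       x = refl
  ⟦⟧⁻¹-inverseˡ (i ∷ ws) x =
    trans (cong ⟦ ws ⟧⁻¹ (Generator.s-involutive i (⟦ ws ⟧ x))) (⟦⟧⁻¹-inverseˡ ws x)

  ⟦⟧⁻¹-inverseʳ : ∀ ws x → ⟦ ws ⟧ (⟦ ws ⟧⁻¹ x) ≡ x
  ⟦⟧⁻¹-inverseʳ []       x = refl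
  ⟦⟧⁻¹-inverseʳ (i ∷ ws) x =
    trans (cong (gen e i) (⟦⟧⁻¹-inverseʳ ws (gen e i x))) (Generator.s-involutive i x)

  ⟦⟧-injective : ∀ ws {x y} → ⟦ ws ⟧ x ≡ ⟦ ws ⟧ y → x ≡ y
  ⟦⟧-injective ws {x} {y} eq =
    trans (sym (⟦⟧⁻¹-inverseˡ ws x)) (trans (cong ⟦ ws ⟧⁻¹ eq) (⟦⟧⁻¹-inverseˡ ws y))

  ⟦⟧-periodic : ∀ ws x q → ⟦ ws ⟧ (x + q * + e) ≡ ⟦ ws ⟧ x + q * + e
  ⟦⟧-periodic []       x q = refl
  ⟦⟧-periodic (i ∷ ws) x q =
    trans (cong (gen e i) (⟦⟧-periodic ws x q)) (Generator.s-periodic i (⟦ ws ⟧ x) q)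

  ⟦⟧≤i+length : ∀ ws x → ⟦ ws ⟧ x ℤ.≤ x + + length ws
  ⟦⟧≤i+length []       x = ℤP.≤-reflexive (sym (ℤP.+-identityʳ x))
  ⟦⟧≤i+length (i ∷ ws) x = begin
    gen e i (⟦ ws ⟧ x)        ≤⟨ Generator.s≤i+1 i (⟦ ws ⟧ x) ⟩
    ⟦ ws ⟧ x + 1ℤ             ≤⟨ ℤP.+-monoˡ-≤ 1ℤ (⟦⟧≤i+length ws x) ⟩
    x + + length ws + 1ℤ      ≡⟨ ℤP.+-assoc x (+ length ws) 1ℤ ⟩
    x + (+ length ws + 1ℤ)    ≡⟨ cong (λ t → x + t) (ℤP.+-comm (+ length ws) 1ℤ) ⟩
    x + + length (i ∷ ws)     ∎
    where open ℤP.≤-Reasoning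

  i≤⟦⟧+length : ∀ ws x → x ℤ.≤ ⟦ ws ⟧ x + + length ws
  i≤⟦⟧+length []       x = ℤP.≤-reflexive (sym (ℤP.+-identityʳ x))
  i≤⟦⟧+length (i ∷ ws) x = begin
    x                                       ≤⟨ i≤⟦⟧+length ws x ⟩
    ⟦ ws ⟧ x + + length ws                  ≤⟨ ℤP.+-monoˡ-≤ (+ length ws) (Generator.i≤s+1 i (⟦ ws ⟧ x)) ⟩
    gen e i (⟦ ws ⟧ x) + 1ℤ + + length ws   ≡⟨ ℤP.+-assoc (gen e i (⟦ ws ⟧ x)) 1ℤ (+ length ws) ⟩
    gen e i (⟦ ws ⟧ x) + + length (i ∷ ws)  ∎
    where open ℤP.≤-Reasoning

  -- Every inversion of an affine permutation is a translate by a multiple of e of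
  -- exactly one pair (a, a + d + 1) with a < e, so once N exceeds all inversion
  -- gaps, inversions N f counts the inversions of f up to translation: ℓ(f).
  inv : (ℤ → ℤ) → ℕ → ℕ → ℕ
  inv f a d = 𝟙 (f (+ a + + suc d) ℤP.<? f (+ a))

  inversions : ℕ → (ℤ → ℤ) → ℕ
  inversions N f = ∑[ a < e ] ∑< N (inv f a)

  ShortInversions : ℕ → (ℤ → ℤ) → Set
  ShortInversions N f = ∀ x d → f (x + + suc d) ℤ.< f x → d < N

  -- sᵢ ∘ f orders x, y differently from f only if {f x, f y} = {i + te, i + 1 + te},
  -- that is, only on the translates of (P, Q) = (f⁻¹ i, f⁻¹ (i + 1)).
  module LeftMultiplication (ws : List (Fin e)) (i : Fin e) where
    open Generator i

    f h : ℤ → ℤ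
    f = ⟦ ws ⟧
    h = ⟦ i ∷ ws ⟧

    P Q : ℤ
    P = ⟦ ws ⟧⁻¹ (+ ι)
    Q = ⟦ ws ⟧⁻¹ (+ ι + 1ℤ)

    f[P+te] : ∀ t → f (P + t * + e) ≡ + ι + t * + e
    f[P+te] t = trans (⟦⟧-periodic ws P t) (cong (_+ t * + e) (⟦⟧⁻¹-inverseʳ ws (+ ι)))

    f[Q+te] : ∀ t → f (Q + t * + e) ≡ + ι + t * + e + 1ℤ
    f[Q+te] t = trans (⟦⟧-periodic ws Q t)
                      (trans (cong (_+ t * + e) (⟦⟧⁻¹-inverseʳ ws (+ ι + 1ℤ))) (xy+z≡xz+y (+ ι) 1ℤ (t * + e)))

    ≡P+te : ∀ {x} t → f x ≡ + ι + t * + e → x ≡ P + t * + e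
    ≡P+te {x} t fx≡ = ⟦⟧-injective ws (trans fx≡ (sym (f[P+te] t)))

    ≡Q+te : ∀ {x} t → f x ≡ + ι + t * + e + 1ℤ → x ≡ Q + t * + e
    ≡Q+te {x} t fx≡ = ⟦⟧-injective ws (trans fx≡ (sym (f[Q+te] t)))

    [ι+te]%ℕe≡ι : ∀ t → (+ ι + t * + e) %ℕ e ≡ ι
    [ι+te]%ℕe≡ι t = [r+qe]%ℕe≡r t (FinP.toℕ<n i)

    s[ι+te] : ∀ t → s (+ ι + t * + e) ≡ + ι + t * + e + 1ℤ
    s[ι+te] t = s-raise (+ ι + t * + e) ([ι+te]%ℕe≡ι t)

    s[ι+te+1] : ∀ t → s (+ ι + t * + e + 1ℤ) ≡ + ι + t * + e
    s[ι+te+1] t = trans (s-lower (α + 1ℤ) ([x+1]%ℕe≡ι′ α ([ι+te]%ℕe≡ι t))) (i+1-1≡i α)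
      where α = + ι + t * + e

    P≢Q : P ≢ Q
    P≢Q P≡Q = ℤP.<⇒≢ (i<i+1 (+ ι))
      (trans (sym (⟦⟧⁻¹-inverseʳ ws (+ ι))) (trans (cong f P≡Q) (⟦⟧⁻¹-inverseʳ ws (+ ι + 1ℤ))))

    P<Q⊎Q<P : P ℤ.< Q ⊎ Q ℤ.< P
    P<Q⊎Q<P with ℤP.<-cmp P Q
    ... | tri< P<Q _ _ = inj₁ P<Q
    ... | tri≈ _ P≡Q _ = contradiction P≡Q P≢Q
    ... | tri> _ _ Q<P = inj₂ Q<P

    Adjacent : ℤ → ℤ → Set
    Adjacent x y = f x %ℕ e ≡ ι × f y ≡ f x + 1ℤ

    adjacent⇒translate : ∀ {x y} → Adjacent x y → ∃[ t ] (x ≡ P + t * + e × y ≡ Q + t * + e)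
    adjacent⇒translate {x} {y} (fx≡ι , fy≡fx+1) = t , ≡P+te t fx≡ , ≡Q+te t (trans fy≡fx+1 (cong (_+ 1ℤ) fx≡))
      where
      t = f x /ℕ e
      fx≡ : f x ≡ + ι + t * + e
      fx≡ = trans (a≡a%ℕn+[a/ℕn]*n (f x) e) (cong (λ r → + r + t * + e) fx≡ι)

    order-unchanged : ∀ {x y} → x ≢ y → ¬ Adjacent x y → ¬ Adjacent y x →
                      𝟙 (h y ℤP.<? h x) ≡ 𝟙 (f y ℤP.<? f x)
    order-unchanged {x} {y} x≢y ¬adj ¬adj′ with f y ℤP.<? f x | h y ℤP.<? h x
    ... | yes _     | yes _ = refl
    ... | no _      | no _  = refl
    ... | yes fy<fx | no ¬hy<hx = contradiction (s-monotone fy<fx ¬adj′) ¬hy<hx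
    ... | no ¬fy<fx | yes hy<hx with ℤP.<-cmp (f x) (f y)
    ...   | tri< fx<fy _ _ = contradiction hy<hx (ℤP.<-asym (s-monotone fx<fy ¬adj))
    ...   | tri≈ _ fx≡fy _ = contradiction (⟦⟧-injective ws fx≡fy) x≢y
    ...   | tri> _ _ fy<fx = contradiction fy<fx ¬fy<fx

    Translates : ℤ → ℤ → Set
    Translates lo hi = ∀ {x y} → x ℤ.< y → Adjacent x y ⊎ Adjacent y x →
                       ∃[ t ] (x ≡ lo + t * + e × y ≡ hi + t * + e)

    translates-ascent : P ℤ.< Q → Translates P Q
    translates-ascent P<Q x<y (inj₁ adj) = adjacent⇒translate adj
    translates-ascent P<Q x<y (inj₂ adj) with adjacent⇒translate adj
    ... | t , y≡ , x≡ = contradiction (+-cancelʳ-< (t * + e) (subst₂ ℤ._<_ x≡ y≡ x<y)) (ℤP.<-asym P<Q)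

    translates-descent : Q ℤ.< P → Translates Q P
    translates-descent Q<P x<y (inj₁ adj) with adjacent⇒translate adj
    ... | t , x≡ , y≡ = contradiction (+-cancelʳ-< (t * + e) (subst₂ ℤ._<_ x≡ y≡ x<y)) (ℤP.<-asym Q<P)
    translates-descent Q<P x<y (inj₂ adj) with adjacent⇒translate adj
    ... | t , y≡ , x≡ = t , x≡ , y≡

    -- (base, base + gap + 1) is the translate of (lo, hi) whose left end lies in [0, e).
    module Window {lo hi} (lo<hi : lo ℤ.< hi) (translates : Translates lo hi) where

      gap : ℕ
      gap = proj₁ (<⇒≡+suc lo<hi)

      hi≡lo+gap : hi ≡ lo + + suc gap
      hi≡lo+gap = proj₂ (<⇒≡+suc lo<hi)

      base : ℕ
      base = lo %ℕ e

      t₀ : ℤ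
      t₀ = - (lo /ℕ e)

      +base≡lo+t₀e : + base ≡ lo + t₀ * + e
      +base≡lo+t₀e = %ℕ-as-shift lo

      +base+gap≡hi+t₀e : + base + + suc gap ≡ hi + t₀ * + e
      +base+gap≡hi+t₀e = begin
        + base + + suc gap         ≡⟨ cong (_+ + suc gap) +base≡lo+t₀e ⟩
        lo + t₀ * + e + + suc gap  ≡⟨ xy+z≡xz+y lo (t₀ * + e) (+ suc gap) ⟩
        lo + + suc gap + t₀ * + e  ≡⟨ cong (_+ t₀ * + e) hi≡lo+gap ⟨
        hi + t₀ * + e              ∎
        where open ≡-Reasoning

      only-window-pair : ∀ {a d} → a < e →
                         Adjacent (+ a) (+ a + + suc d) ⊎ Adjacent (+ a + + suc d) (+ a) →
                         a ≡ base × d ≡ gap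
      only-window-pair {a} {d} a<e adj with translates (i<i+suc (+ a) d) adj
      ... | t , a≡ , a+d≡ = a≡base , ℕP.suc-injective (ℤP.+-injective (+-cancelˡ (+ a) (+ suc d) (+ suc gap) gaps))
        where
        a≡base : a ≡ base
        a≡base = trans (sym (ℕD.m<n⇒m%n≡m a<e)) (trans (cong (_%ℕ e) a≡) ([x+qe]%ℕe≡x%ℕe lo t))
        gaps : + a + + suc d ≡ + a + + suc gap
        gaps = begin
          + a + + suc d              ≡⟨ a+d≡ ⟩
          hi + t * + e               ≡⟨ cong (_+ t * + e) hi≡lo+gap ⟩
          lo + + suc gap + t * + e   ≡⟨ xy+z≡xz+y lo (+ suc gap) (t * + e) ⟩
          lo + t * + e + + suc gap   ≡⟨ cong (_+ + suc gap) a≡ ⟨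
          + a + + suc gap            ∎
          where open ≡-Reasoning

      unchanged-off-window : ∀ {a d} → a < e → (a ≢ base ⊎ d ≢ gap) → inv h a d ≡ inv f a d
      unchanged-off-window {a} {d} a<e off = order-unchanged (ℤP.<⇒≢ (i<i+suc (+ a) d))
          (λ adj → off-window (only-window-pair a<e (inj₁ adj)))
          (λ adj → off-window (only-window-pair a<e (inj₂ adj)))
        where
        off-window : ¬ (a ≡ base × d ≡ gap)
        off-window (a≡base , d≡gap) = [ (λ a≢ → a≢ a≡base) , (λ d≢ → d≢ d≡gap) ]′ off

      inversions-step : ∀ N → gap < N →
                        inversions N h ℕ.+ inv f base gap ≡ inversions N f ℕ.+ inv h base gap
      inversions-step N gap<N = ∑∑-exchange e N (n%ℕd<d lo e) gap<N
                                  (λ a d a<e _ off → unchanged-off-window a<e off)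

      inversions-unchanged : ∀ N → ¬ gap < N → inversions N h ≡ inversions N f
      inversions-unchanged N gap≮N = ∑-cong e (λ a a<e → ∑-cong N (λ d d<N →
        unchanged-off-window a<e (inj₂ (λ d≡gap → gap≮N (subst (_< N) d≡gap d<N)))))

      inversions-≤-window : ∀ N → inversions N h ≤ suc (inversions N f)
      inversions-≤-window N with gap ℕ.<? N
      ... | no gap≮N = ℕP.≤-trans (ℕP.≤-reflexive (inversions-unchanged N gap≮N)) (ℕP.n≤1+n _)
      ... | yes gap<N = begin
        inversions N h                               ≤⟨ ℕP.m≤m+n _ _ ⟩
        inversions N h ℕ.+ inv f base gap            ≡⟨ inversions-step N gap<N ⟩
        inversions N f ℕ.+ inv h base gap            ≤⟨ ℕP.+-monoʳ-≤ (inversions N f) (𝟙≤1 _) ⟩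
        inversions N f ℕ.+ 1                         ≡⟨ ℕP.+-comm (inversions N f) 1 ⟩
        suc (inversions N f)                         ∎
        where open ℕP.≤-Reasoning

    inversions-≤ : ∀ N → inversions N h ≤ suc (inversions N f)
    inversions-≤ N = [ (λ P<Q → Window.inversions-≤-window P<Q (translates-ascent P<Q) N)
                     , (λ Q<P → Window.inversions-≤-window Q<P (translates-descent Q<P) N) ]′ P<Q⊎Q<P

    inversions-ascent : ∀ N → P ℤ.< Q → ShortInversions N h → inversions N h ≡ suc (inversions N f)
    inversions-ascent N P<Q short = begin
      inversions N h                    ≡⟨ ℕP.+-identityʳ _ ⟨
      inversions N h ℕ.+ 0              ≡⟨ cong (inversions N h ℕ.+_) inv-f ⟨
      inversions N h ℕ.+ inv f base gap ≡⟨ inversions-step N gap<N ⟩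
      inversions N f ℕ.+ inv h base gap ≡⟨ cong (inversions N f ℕ.+_) inv-h ⟩
      inversions N f ℕ.+ 1              ≡⟨ ℕP.+-comm (inversions N f) 1 ⟩
      suc (inversions N f)              ∎
      where
      open Window P<Q (translates-ascent P<Q)
      open ≡-Reasoning
      α = + ι + t₀ * + e
      f-left : f (+ base) ≡ α
      f-left = trans (cong f +base≡lo+t₀e) (f[P+te] t₀)
      f-right : f (+ base + + suc gap) ≡ α + 1ℤ
      f-right = trans (cong f +base+gap≡hi+t₀e) (f[Q+te] t₀)
      h-left : h (+ base) ≡ α + 1ℤ
      h-left = trans (cong s f-left) (s[ι+te] t₀)
      h-right : h (+ base + + suc gap) ≡ α
      h-right = trans (cong s f-right) (s[ι+te+1] t₀)
      inv-f : inv f base gap ≡ 0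
      inv-f = 𝟙-no (_ ℤP.<? _) (subst₂ (λ u v → ¬ u ℤ.< v) (sym f-right) (sym f-left) (ℤP.<-asym (i<i+1 α)))
      inv-h : inv h base gap ≡ 1
      inv-h = 𝟙-yes (_ ℤP.<? _) (subst₂ ℤ._<_ (sym h-right) (sym h-left) (i<i+1 α))
      gap<N : gap < N
      gap<N = short (+ base) gap (subst₂ ℤ._<_ (sym h-right) (sym h-left) (i<i+1 α))

    inversions-descent : ∀ N → Q ℤ.< P → ShortInversions N f → suc (inversions N h) ≡ inversions N f
    inversions-descent N Q<P short = begin
      suc (inversions N h)              ≡⟨ ℕP.+-comm 1 (inversions N h) ⟩
      inversions N h ℕ.+ 1              ≡⟨ cong (inversions N h ℕ.+_) inv-f ⟨
      inversions N h ℕ.+ inv f base gap ≡⟨ inversions-step N gap<N ⟩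
      inversions N f ℕ.+ inv h base gap ≡⟨ cong (inversions N f ℕ.+_) inv-h ⟩
      inversions N f ℕ.+ 0              ≡⟨ ℕP.+-identityʳ _ ⟩
      inversions N f                    ∎
      where
      open Window Q<P (translates-descent Q<P)
      open ≡-Reasoning
      α = + ι + t₀ * + e
      f-left : f (+ base) ≡ α + 1ℤ
      f-left = trans (cong f +base≡lo+t₀e) (f[Q+te] t₀)
      f-right : f (+ base + + suc gap) ≡ α
      f-right = trans (cong f +base+gap≡hi+t₀e) (f[P+te] t₀)
      h-left : h (+ base) ≡ α
      h-left = trans (cong s f-left) (s[ι+te+1] t₀)
      h-right : h (+ base + + suc gap) ≡ α + 1ℤ
      h-right = trans (cong s f-right) (s[ι+te] t₀)
      inv-f : inv f base gap ≡ 1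
      inv-f = 𝟙-yes (_ ℤP.<? _) (subst₂ ℤ._<_ (sym f-right) (sym f-left) (i<i+1 α))
      inv-h : inv h base gap ≡ 0
      inv-h = 𝟙-no (_ ℤP.<? _) (subst₂ (λ u v → ¬ u ℤ.< v) (sym h-right) (sym h-left) (ℤP.<-asym (i<i+1 α)))
      gap<N : gap < N
      gap<N = short (+ base) gap (subst₂ ℤ._<_ (sym f-right) (sym f-left) (i<i+1 α))

    short-descent : ∀ N → Q ℤ.< P → ShortInversions N f → ShortInversions N h
    short-descent N Q<P short x d hy<hx with f (x + + suc d) ℤP.<? f x
    ... | yes fy<fx = short x d fy<fx
    ... | no fy≮fx with ℤP.<-cmp (f x) (f (x + + suc d))
    ...   | tri> _ _ fy<fx = contradiction fy<fx fy≮fx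
    ...   | tri≈ _ fx≡fy _ = contradiction (⟦⟧-injective ws fx≡fy) (ℤP.<⇒≢ (i<i+suc x d))
    ...   | tri< fx<fy _ _ with adjacent⇒translate (flip⇒adjacent fx<fy hy<hx)
    ...     | t , x≡ , y≡ = contradiction (+-cancelʳ-< (t * + e) (subst₂ ℤ._<_ x≡ y≡ (i<i+suc x d))) (ℤP.<-asym Q<P)

  inversions-cong : ∀ N {F G} → (∀ x → F x ≡ G x) → inversions N F ≡ inversions N G
  inversions-cong N F≗G = ∑-cong e (λ a _ → ∑-cong N (λ d _ →
    cong₂ (λ u v → 𝟙 (u ℤP.<? v)) (F≗G _) (F≗G _)))

  inversions-id : ∀ N → inversions N id ≡ 0
  inversions-id N = trans (∑-cong e (λ a _ → trans (∑-cong N (λ d _ →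
                      𝟙-no (_ ℤP.<? _) (ℤP.<-asym (i<i+suc (+ a) d)))) (∑-zero N)))
                    (∑-zero e)

  inversions≤length : ∀ N ws → inversions N ⟦ ws ⟧ ≤ length ws
  inversions≤length N []       = ℕP.≤-reflexive (inversions-id N)
  inversions≤length N (i ∷ ws) = ℕP.≤-trans (LeftMultiplication.inversions-≤ ws i N) (s≤s (inversions≤length N ws))

  inversions≤product-length : ∀ N {F m} → ProductOfGens e F m → inversions N F ≤ m
  inversions≤product-length N (ws , refl , ⟦ws⟧≗F) =
    subst (_≤ length ws) (inversions-cong N ⟦ws⟧≗F) (inversions≤length N ws)

  ShortInversions-mono : ∀ {M N F} → M ≤ N → ShortInversions M F → ShortInversions N F
  ShortInversions-mono M≤N short x d inverted = ℕP.<-≤-trans (short x d inverted) M≤N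

  short-inversions : ∀ ws → ShortInversions (length ws ℕ.+ length ws) ⟦ ws ⟧
  short-inversions ws x d fy<fx with length ws ℕ.+ length ws ℕ.≤? d
  ... | no d≱2L = ℕP.≰⇒> d≱2L
  ... | yes 2L≤d = contradiction fy<fx (ℤP.≤⇒≯ (≤-from-diff nonneg (split fy fx x (+ d) (+ L))))
    where
    L = length ws
    fy = ⟦ ws ⟧ (x + + suc d)
    fx = ⟦ ws ⟧ x
    split : ∀ fy fx x d L → fy - fx ≡ ((fy + L) - (x + (1ℤ + d))) + ((x + L) - fx) + (d - (L + L)) + 1ℤ
    split = solve-∀
    nonneg = ℤP.+-mono-≤ (ℤP.+-mono-≤ (ℤP.+-mono-≤ (ℤP.i≤j⇒0≤j-i (i≤⟦⟧+length ws (x + + suc d)))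
                                                   (ℤP.i≤j⇒0≤j-i (⟦⟧≤i+length ws x)))
                                     (ℤP.i≤j⇒0≤j-i (subst (ℤ._≤ + d) (ℤP.pos-+ L L) (ℤ.+≤+ 2L≤d))))
                         (0≤+ 1)

  residue-hit-once : ∀ ws {r} → r < e → ∑[ a < e ] 𝟙 (⟦ ws ⟧ (+ a) %ℕ e ℕ.≟ r) ≡ 1
  residue-hit-once ws {r} r<e = begin
    ∑< e hits                  ≡⟨ ℕP.+-identityʳ _ ⟨
    ∑< e hits ℕ.+ 0            ≡⟨ ∑-exchange e (n%ℕd<d z e) misses ⟩
    ∑[ a < e ] 0 ℕ.+ hits a₀   ≡⟨ cong₂ ℕ._+_ (∑-zero e) (𝟙-yes (_ ℕ.≟ r) hit) ⟩
    1                          ∎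
    where
    open ≡-Reasoning
    hits : ℕ → ℕ
    hits a = 𝟙 (⟦ ws ⟧ (+ a) %ℕ e ℕ.≟ r)
    z = ⟦ ws ⟧⁻¹ (+ r)
    a₀ = z %ℕ e
    hit : ⟦ ws ⟧ (+ a₀) %ℕ e ≡ r
    hit = begin
      ⟦ ws ⟧ (+ a₀) %ℕ e                        ≡⟨ cong (λ x → ⟦ ws ⟧ x %ℕ e) (%ℕ-as-shift z) ⟩
      ⟦ ws ⟧ (z + - (z /ℕ e) * + e) %ℕ e        ≡⟨ cong (_%ℕ e) (⟦⟧-periodic ws z (- (z /ℕ e))) ⟩
      (⟦ ws ⟧ z + - (z /ℕ e) * + e) %ℕ e        ≡⟨ cong (λ x → (x + - (z /ℕ e) * + e) %ℕ e) (⟦⟧⁻¹-inverseʳ ws (+ r)) ⟩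
      (+ r + - (z /ℕ e) * + e) %ℕ e             ≡⟨ [r+qe]%ℕe≡r (- (z /ℕ e)) r<e ⟩
      r                                         ∎
    misses : ∀ a → a < e → a ≢ a₀ → hits a ≡ 0
    misses a a<e a≢a₀ = 𝟙-no (_ ℕ.≟ r) λ fa≡r → a≢a₀ (begin
      a                   ≡⟨ ℕD.m<n⇒m%n≡m a<e ⟨
      + a %ℕ e            ≡⟨ cong (_%ℕ e) (⟦⟧-injective ws (fa≡ fa≡r)) ⟩
      (z + q * + e) %ℕ e  ≡⟨ [x+qe]%ℕe≡x%ℕe z q ⟩
      a₀                  ∎)
      where
      q = ⟦ ws ⟧ (+ a) /ℕ e
      fa≡ : ⟦ ws ⟧ (+ a) %ℕ e ≡ r → ⟦ ws ⟧ (+ a) ≡ ⟦ ws ⟧ (z + q * + e)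
      fa≡ fa≡r = begin
        ⟦ ws ⟧ (+ a)                   ≡⟨ a≡a%ℕn+[a/ℕn]*n (⟦ ws ⟧ (+ a)) e ⟩
        + (⟦ ws ⟧ (+ a) %ℕ e) + q * + e ≡⟨ cong (λ r′ → + r′ + q * + e) fa≡r ⟩
        + r + q * + e                  ≡⟨ cong (_+ q * + e) (⟦⟧⁻¹-inverseʳ ws (+ r)) ⟨
        ⟦ ws ⟧ z + q * + e             ≡⟨ ⟦⟧-periodic ws z q ⟨
        ⟦ ws ⟧ (z + q * + e)           ∎

  -- The normalisation w(1) + ⋯ + w(e) = e(e + 1)/2 of the affine symmetric group,
  -- proved for products of generators; it rules out nontrivial translations.
  displacement : (ℤ → ℤ) → ℤ
  displacement f = ∑ℤ[ a < e ] (f (+ a) - + a)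

  displacement-step : ∀ i ws → displacement ⟦ i ∷ ws ⟧ ≡ displacement ⟦ ws ⟧
  displacement-step i ws = +-cancelʳ 1ℤ _ _ (begin
    displacement h + 1ℤ                                       ≡⟨ cong (λ t → displacement h + t) (count (ℕD.m%n<n (suc ι) e)) ⟨
    displacement h + ∑ℤ[ a < e ] (+ hit ι′ a)                 ≡⟨ ∑ℤ-distrib-+ e _ _ ⟨
    ∑ℤ[ a < e ] (h (+ a) - + a + + hit ι′ a)                  ≡⟨ ∑ℤ-cong e (λ a _ → regroup a) ⟩
    ∑ℤ[ a < e ] (f (+ a) - + a + + hit ι a)                   ≡⟨ ∑ℤ-distrib-+ e _ _ ⟩
    displacement f + ∑ℤ[ a < e ] (+ hit ι a)                  ≡⟨ cong (λ t → displacement f + t) (count (FinP.toℕ<n i)) ⟩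
    displacement f + 1ℤ                                       ∎)
    where
    open ≡-Reasoning
    open Generator i
    f h : ℤ → ℤ
    f = ⟦ ws ⟧
    h = ⟦ i ∷ ws ⟧
    hit : ℕ → ℕ → ℕ
    hit r a = 𝟙 (f (+ a) %ℕ e ℕ.≟ r)
    count : ∀ {r} → r < e → ∑ℤ[ a < e ] (+ hit r a) ≡ 1ℤ
    count {r} r<e = trans (∑ℤ-+ e (hit r)) (cong +_ (residue-hit-once ws r<e))
    split : ∀ sy y a c → sy - a + c ≡ y - a + (sy - y + c)
    split = solve-∀
    regroup : ∀ a → h (+ a) - + a + + hit ι′ a ≡ f (+ a) - + a + + hit ι a
    regroup a = trans (split (h (+ a)) (f (+ a)) (+ a) _) (cong (λ t → f (+ a) - + a + t) (s-displacement (f (+ a))))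

  displacement≡0 : ∀ ws → displacement ⟦ ws ⟧ ≡ 0ℤ
  displacement≡0 []       = trans (∑ℤ-cong e (λ a _ → ℤP.+-inverseʳ (+ a)))
                                  (trans (∑ℤ-const e 0ℤ) (ℤP.*-zeroʳ (+ e)))
  displacement≡0 (i ∷ ws) = trans (displacement-step i ws) (displacement≡0 ws)

  translation≡0 : ∀ ws {c} → (∀ x → ⟦ ws ⟧ x ≡ x + c) → c ≡ 0ℤ
  translation≡0 ws {c} ⟦ws⟧≡+c = ℤP.*-cancelˡ-≡ (+ e) c 0ℤ (begin
    + e * c                       ≡⟨ ∑ℤ-const e c ⟨
    ∑ℤ[ a < e ] c                 ≡⟨ ∑ℤ-cong e (λ a _ → trans (sym (cancel (+ a) c)) (cong (_- + a) (sym (⟦ws⟧≡+c (+ a))))) ⟩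
    displacement ⟦ ws ⟧           ≡⟨ displacement≡0 ws ⟩
    0ℤ                            ≡⟨ ℤP.*-zeroʳ (+ e) ⟨
    + e * 0ℤ                      ∎)
    where
    open ≡-Reasoning
    cancel : ∀ a c → a + c - a ≡ c
    cancel = solve-∀

  -- Without inversions f is monotone, hence a translation, hence the identity.
  module NoInversions {N} ws (short : ShortInversions N ⟦ ws ⟧) (none : inversions N ⟦ ws ⟧ ≡ 0) where
    private
      f = ⟦ ws ⟧

    not-inverted : ∀ x d → ¬ f (x + + suc d) ℤ.< f x
    not-inverted x d fy<fx = contradiction (trans (sym (𝟙-yes (_ ℤP.<? _) window-inverted)) inv≡0) λ ()
      where
      a = x %ℕ e
      t = x /ℕ e
      x≡ : x ≡ + a + t * + e
      x≡ = a≡a%ℕn+[a/ℕn]*n x e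
      y≡ : x + + suc d ≡ + a + + suc d + t * + e
      y≡ = trans (cong (_+ + suc d) x≡) (xy+z≡xz+y (+ a) (t * + e) (+ suc d))
      window-inverted : f (+ a + + suc d) ℤ.< f (+ a)
      window-inverted = +-cancelʳ-< (t * + e)
        (subst₂ ℤ._<_ (trans (cong f y≡) (⟦⟧-periodic ws _ t)) (trans (cong f x≡) (⟦⟧-periodic ws _ t)) fy<fx)
      inv≡0 : inv f a d ≡ 0
      inv≡0 = ∑≡0⇒≡0 N (∑≡0⇒≡0 e none (n%ℕd<d x e)) (short x d fy<fx)

    monotone : ∀ {u v} → u ℤ.≤ v → f u ℤ.≤ f v
    monotone {u} {v} u≤v with ℤP.<-cmp u v
    ... | tri≈ _ refl _ = ℤP.≤-refl
    ... | tri> _ _ v<u  = contradiction u≤v (ℤP.<⇒≱ v<u)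
    ... | tri< u<v _ _ with <⇒≡+suc u<v
    ...   | d , refl = ℤP.≮⇒≥ (not-inverted u d)

    f[x+1] : ∀ x → f (x + 1ℤ) ≡ f x + 1ℤ
    f[x+1] x = ℤP.≤-antisym (subst (f (x + 1ℤ) ℤ.≤_) fz≡ (monotone x+1≤z))
                           (subst (ℤ._≤ f (x + 1ℤ)) (ℤP.+-comm 1ℤ (f x)) (ℤP.i<j⇒suc[i]≤j fx<fx+1))
      where
      z = ⟦ ws ⟧⁻¹ (f x + 1ℤ)
      fz≡ : f z ≡ f x + 1ℤ
      fz≡ = ⟦⟧⁻¹-inverseʳ ws (f x + 1ℤ)
      x+1≤z : x + 1ℤ ℤ.≤ z
      x+1≤z = subst (ℤ._≤ z) (ℤP.+-comm 1ℤ x) (ℤP.i<j⇒suc[i]≤j (ℤP.≰⇒> λ z≤x →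
                ℤP.<⇒≱ (subst (f x ℤ.<_) (sym fz≡) (i<i+1 (f x))) (monotone z≤x)))
      fx<fx+1 : f x ℤ.< f (x + 1ℤ)
      fx<fx+1 = ℤP.≤∧≢⇒< (monotone (ℤP.<⇒≤ (i<i+1 x)))
                          (λ eq → ℤP.<⇒≢ (i<i+1 x) (⟦⟧-injective ws eq))

    translation : ∀ x → f x ≡ x + f 0ℤ
    translation (+ n)    = upward n
      where
      upward : ∀ n → f (+ n) ≡ + n + f 0ℤ
      upward zero    = sym (ℤP.+-identityˡ (f 0ℤ))
      upward (suc n) = begin
        f (+ suc n)          ≡⟨ cong f (ℤP.+-comm 1ℤ (+ n)) ⟩
        f (+ n + 1ℤ)         ≡⟨ f[x+1] (+ n) ⟩
        f (+ n) + 1ℤ         ≡⟨ cong (_+ 1ℤ) (upward n) ⟩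
        + n + f 0ℤ + 1ℤ      ≡⟨ xy+z≡xz+y (+ n) (f 0ℤ) 1ℤ ⟩
        + n + 1ℤ + f 0ℤ      ≡⟨ cong (_+ f 0ℤ) (ℤP.+-comm (+ n) 1ℤ) ⟩
        + suc n + f 0ℤ       ∎
        where open ≡-Reasoning
    translation -[1+ n ] = +-cancelʳ 1ℤ _ _ (begin
      f -[1+ n ] + 1ℤ            ≡⟨ f[x+1] -[1+ n ] ⟨
      f (-[1+ n ] + 1ℤ)          ≡⟨ previous n ⟩
      -[1+ n ] + 1ℤ + f 0ℤ       ≡⟨ xy+z≡xz+y -[1+ n ] 1ℤ (f 0ℤ) ⟩
      -[1+ n ] + f 0ℤ + 1ℤ       ∎)
      where
      open ≡-Reasoning
      previous : ∀ n → f (-[1+ n ] + 1ℤ) ≡ -[1+ n ] + 1ℤ + f 0ℤ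
      previous zero    = sym (ℤP.+-identityˡ (f 0ℤ))
      previous (suc n) = translation -[1+ n ]

    identity : ∀ x → f x ≡ x
    identity x = trans (translation x)
                       (trans (cong (λ c → x + c) (translation≡0 ws translation)) (ℤP.+-identityʳ x))

  inverted-consecutive-values : ∀ ws {x y} → x ℤ.< y → ⟦ ws ⟧ y ℤ.< ⟦ ws ⟧ x →
    ∃[ j ] ∃[ p ] ∃[ q ] (q ℤ.< p × ⟦ ws ⟧ p ≡ j × ⟦ ws ⟧ q ≡ j + 1ℤ)
  inverted-consecutive-values ws x<y fy<fx with <⇒≡+suc fy<fx
  ... | gap , fx≡ = walk gap x<y fx≡
    where
    f = ⟦ ws ⟧
    -- Induction on the value gap: either f⁻¹ (f y + 1) lies left of y, and the
    -- values f y, f y + 1 are inverted, or it lies right of y and replaces y.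
    walk : ∀ gap {x y} → x ℤ.< y → f x ≡ f y + + suc gap →
           ∃[ j ] ∃[ p ] ∃[ q ] (q ℤ.< p × f p ≡ j × f q ≡ j + 1ℤ)
    walk zero      {x} {y} x<y fx≡ = f y , y , x , x<y , refl , fx≡
    walk (suc gap) {x} {y} x<y fx≡ with ℤP.<-cmp z y
      where z = ⟦ ws ⟧⁻¹ (f y + 1ℤ)
    ... | tri< z<y _ _ = f y , y , z , z<y , refl , ⟦⟧⁻¹-inverseʳ ws (f y + 1ℤ)
      where z = ⟦ ws ⟧⁻¹ (f y + 1ℤ)
    ... | tri≈ _ z≡y _ = contradiction (trans (sym (⟦⟧⁻¹-inverseʳ ws (f y + 1ℤ))) (cong f z≡y))
                                       (ℤP.<⇒≢ (i<i+1 (f y)) ∘ sym)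
    ... | tri> _ _ y<z = walk gap (ℤP.<-trans x<y y<z) (trans fx≡ (trans (shift (f y) (+ gap))
                           (cong (_+ + suc gap) (sym (⟦⟧⁻¹-inverseʳ ws (f y + 1ℤ))))))
      where
      shift : ∀ a g → a + (1ℤ + (1ℤ + g)) ≡ a + 1ℤ + (1ℤ + g)
      shift = solve-∀

  has-descent : ∀ {N ws} → ShortInversions N ⟦ ws ⟧ → inversions N ⟦ ws ⟧ ≢ 0 →
                ∃[ i ] LeftMultiplication.Q ws i ℤ.< LeftMultiplication.P ws i
  has-descent {N} {ws} short inversions≢0
    with ∑≢0⇒∃≢0 e inversions≢0
  ... | a , _ , row≢0 with ∑≢0⇒∃≢0 N row≢0
  ... | d , _ , inv≢0 with inverted-consecutive-values ws (i<i+suc (+ a) d) (𝟙≢0⇒ (_ ℤP.<? _) inv≢0)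
  ... | j , p , q , q<p , fp≡j , fq≡j+1 = i , +-cancelʳ-< (t * + e) (subst₂ ℤ._<_ q≡ p≡ q<p)
    where
    i = fromℕ< (n%ℕd<d j e)
    open LeftMultiplication ws i using (≡P+te; ≡Q+te)
    t = j /ℕ e
    j≡ : j ≡ + toℕ i + t * + e
    j≡ = trans (a≡a%ℕn+[a/ℕn]*n j e) (cong (λ r → + r + t * + e) (sym (FinP.toℕ-fromℕ< (n%ℕd<d j e))))
    p≡ : p ≡ LeftMultiplication.P ws i + t * + e
    p≡ = ≡P+te t (trans fp≡j j≡)
    q≡ : q ≡ LeftMultiplication.Q ws i + t * + e
    q≡ = ≡Q+te t (trans fq≡j+1 (cong (_+ 1ℤ) j≡))

  prepend : ∀ i ws {c} → ProductOfGens e ⟦ i ∷ ws ⟧ c → ProductOfGens e ⟦ ws ⟧ (suc c)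
  prepend i ws (ws′ , length≡c , ⟦ws′⟧≗) =
    i ∷ ws′ , cong suc length≡c , λ x → trans (cong (gen e i) (⟦ws′⟧≗ x)) (Generator.s-involutive i (⟦ ws ⟧ x))

  word-of-length : ∀ N c ws → ShortInversions N ⟦ ws ⟧ → inversions N ⟦ ws ⟧ ≡ c →
                   ProductOfGens e ⟦ ws ⟧ c
  word-of-length N zero    ws short none  = [] , refl , λ x → sym (NoInversions.identity ws short none x)
  word-of-length N (suc c) ws short count = extend (has-descent {N} {ws} short (λ none → ℕP.0≢1+n (trans (sym none) count)))
    where
    extend : ∃[ i ] LeftMultiplication.Q ws i ℤ.< LeftMultiplication.P ws i → ProductOfGens e ⟦ ws ⟧ (suc c)
    extend (i , Q<P) = prepend i ws (word-of-length N c (i ∷ ws) (LeftMultiplication.short-descent ws i N Q<P short)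
                         (ℕP.suc-injective (trans (LeftMultiplication.inversions-descent ws i N Q<P short) count)))

  length≡inversions : ∀ N ws {F ℓ} → ShortInversions N ⟦ ws ⟧ → (∀ x → ⟦ ws ⟧ x ≡ F x) → IsLength e F ℓ →
                      ℓ ≡ inversions N ⟦ ws ⟧
  length≡inversions N ws {F} {ℓ} short ⟦ws⟧≗F (product , minimal) with word-of-length N _ ws short refl
  ... | ws′ , length≡ , ⟦ws′⟧≗ = ℕP.≤-antisym
    (minimal _ (ws′ , length≡ , λ x → trans (⟦ws′⟧≗ x) (⟦ws⟧≗F x)))
    (subst (_≤ ℓ) (inversions-cong N (sym ∘ ⟦ws⟧≗F)) (inversions≤product-length N product))

  length-change : ∀ ws i {F n m} → (∀ x → ⟦ ws ⟧ x ≡ F x) → IsLength e F n → IsLength e (gen e i ∘ F) m →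
                  let open LeftMultiplication ws i in (P ℤ.< Q → m ≡ suc n) × (Q ℤ.< P → suc m ≡ n)
  length-change ws i {F} ⟦ws⟧≗F ℓ[F]≡n ℓ[sF]≡m =
    (λ P<Q → trans m≡ (trans (LeftMultiplication.inversions-ascent ws i N P<Q short-h) (cong suc (sym n≡)))) ,
    (λ Q<P → trans (cong suc m≡) (trans (LeftMultiplication.inversions-descent ws i N Q<P short-f) (sym n≡)))
    where
    L = length (i ∷ ws)
    -- generators move points by at most 1, so 2L bounds the inversion gaps of f and sᵢ ∘ f
    N = L ℕ.+ L
    short-h : ShortInversions N ⟦ i ∷ ws ⟧
    short-h = short-inversions (i ∷ ws)
    short-f : ShortInversions N ⟦ ws ⟧
    short-f = ShortInversions-mono (ℕP.+-mono-≤ (ℕP.n≤1+n _) (ℕP.n≤1+n _)) (short-inversions ws)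
    n≡ = length≡inversions N ws short-f ⟦ws⟧≗F ℓ[F]≡n
    m≡ = length≡inversions N (i ∷ ws) short-h (cong (gen e i) ∘ ⟦ws⟧≗F) ℓ[sF]≡m

  module AbacusEdges (ws : List (Fin e)) (i : Fin e) where
    open LeftMultiplication ws i using (f; P; Q; f[P+te]; f[Q+te]; ≡P+te; ≡Q+te; [ι+te]%ℕe≡ι)
    open Generator i using (ι)

    A : ℤ → ℤ → Set
    A = ImageOfEmptyAbacus f

    ≡ι+te : ∀ x → x %ℕ e ≡ ι → x ≡ + ι + (x /ℕ e) * + e
    ≡ι+te x x≡ι = trans (a≡a%ℕn+[a/ℕn]*n x e) (cong (λ r → + r + (x /ℕ e) * + e) x≡ι)

    addable-edge⇒P<Q : ∀ {c x} → x %ℕ e ≡ ι → AddableEdge (A c) x → P ℤ.< Q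
    addable-edge⇒P<Q {c} {x} x≡ι ((y , y≤c , fy≡x) , x+1∉A) =
      +-cancelʳ-< (t * + e) (ℤP.≤-<-trans (subst (ℤ._≤ c) (≡P+te t (trans fy≡x x≡)) y≤c) c<Q+te)
      where
      t = x /ℕ e
      x≡ = ≡ι+te x x≡ι
      c<Q+te : c ℤ.< Q + t * + e
      c<Q+te = ℤP.≰⇒> λ Q+te≤c → x+1∉A (Q + t * + e , Q+te≤c , trans (f[Q+te] t) (cong (_+ 1ℤ) (sym x≡)))

    removable-edge⇒Q<P : ∀ {c x} → x %ℕ e ≡ ι → RemovableEdge (A c) x → Q ℤ.< P
    removable-edge⇒Q<P {c} {x} x≡ι (x∉A , (y , y≤c , fy≡x+1)) =
      +-cancelʳ-< (t * + e) (ℤP.≤-<-trans (subst (ℤ._≤ c) (≡Q+te t (trans fy≡x+1 (cong (_+ 1ℤ) x≡))) y≤c) c<P+te)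
      where
      t = x /ℕ e
      x≡ = ≡ι+te x x≡ι
      c<P+te : c ℤ.< P + t * + e
      c<P+te = ℤP.≰⇒> λ P+te≤c → x∉A (P + t * + e , P+te≤c , trans (f[P+te] t) (sym x≡))

    window-charge : ∀ z → ∃[ c ] (+ toℕ c ≡ z + (- (z /ℕ e)) * + e)
    window-charge z = fromℕ< (n%ℕd<d z e) , trans (cong +_ (FinP.toℕ-fromℕ< (n%ℕd<d z e))) (%ℕ-as-shift z)

    P<Q⇒addable-edge : P ℤ.< Q → ∃[ c ] ∃[ x ] (x %ℕ e ≡ ι × AddableEdge (A (+ toℕ c)) x)
    P<Q⇒addable-edge P<Q with window-charge P
    ... | c , c≡P+te = c , + ι + t * + e , [ι+te]%ℕe≡ι t , ι+te∈A , ι+te+1∉A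
      where
      t = - (P /ℕ e)
      ι+te∈A : A (+ toℕ c) (+ ι + t * + e)
      ι+te∈A = P + t * + e , ℤP.≤-reflexive (sym c≡P+te) , f[P+te] t
      ι+te+1∉A : ¬ A (+ toℕ c) (+ ι + t * + e + 1ℤ)
      ι+te+1∉A (y , y≤c , fy≡) =
        ℤP.<⇒≱ (ℤP.+-monoˡ-< (t * + e) P<Q) (subst₂ ℤ._≤_ (≡Q+te t fy≡) c≡P+te y≤c)

    Q<P⇒removable-edge : Q ℤ.< P → ∃[ c ] ∃[ x ] (x %ℕ e ≡ ι × RemovableEdge (A (+ toℕ c)) x)
    Q<P⇒removable-edge Q<P with window-charge Q
    ... | c , c≡Q+te = c , + ι + t * + e , [ι+te]%ℕe≡ι t , ι+te∉A , ι+te+1∈A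
      where
      t = - (Q /ℕ e)
      ι+te∉A : ¬ A (+ toℕ c) (+ ι + t * + e)
      ι+te∉A (y , y≤c , fy≡) =
        ℤP.<⇒≱ (ℤP.+-monoˡ-< (t * + e) Q<P) (subst₂ ℤ._≤_ (≡P+te t fy≡) c≡Q+te y≤c)
      ι+te+1∈A : A (+ toℕ c) (+ ι + t * + e + 1ℤ)
      ι+te+1∈A = Q + t * + e , ℤP.≤-reflexive (sym c≡Q+te) , f[Q+te] t

  module _ (λs : Fin e → ChargedPartition) (ws : List (Fin e)) (i : Fin e)
           (abacus : ∀ c y → InAbacus (λs c) y ⇔ ImageOfEmptyAbacus ⟦ ws ⟧ (+ toℕ c) y) where
    open AbacusEdges ws i
    open LeftMultiplication ws i using (P; Q)

    has-addable⇔P<Q : HasAddable e λs i ⇔ P ℤ.< Q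
    has-addable⇔P<Q = mk⇔
      (λ (c , γ , addable , residue≡ι) →
         addable-edge⇒P<Q residue≡ι (AddableEdge-⇔ (abacus c) (Beads.addable⇒edge (λs c) addable)))
      (λ P<Q → let (c , x , x≡ι , edge) = P<Q⇒addable-edge P<Q
                   (γ , addable , content≡x) = Beads.edge⇒addable (λs c) (AddableEdge-⇔ (⇔-sym ∘ abacus c) edge)
               in c , γ , addable , trans (cong (_%ℕ e) content≡x) x≡ι)

    has-removable⇔Q<P : HasRemovable e λs i ⇔ Q ℤ.< P
    has-removable⇔Q<P = mk⇔
      (λ (c , γ , removable , residue≡ι) →
         removable-edge⇒Q<P residue≡ι (RemovableEdge-⇔ (abacus c) (Beads.removable⇒edge (λs c) removable)))
      (λ Q<P → let (c , x , x≡ι , edge) = Q<P⇒removable-edge Q<P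
                   (γ , removable , content≡x) = Beads.edge⇒removable (λs c) (RemovableEdge-⇔ (⇔-sym ∘ abacus c) edge)
               in c , γ , removable , trans (cong (_%ℕ e) content≡x) x≡ι)

propositionA7 : (e : ℕ) → .{{_ : NonZero e}} → 2 ≤ e →
    (w : AffPerm e) →
    (λs : Fin e → ChargedPartition) →
    (∀ c → HasAbacus (λs c) (ImageOfEmptyAbacus (fun w) (+ toℕ c))) →
    (i : Fin e) →
    (n m : ℕ) → IsLength e (fun w) n → IsLength e (gen e i ∘ fun w) m →
    ((m < n ⇔ HasRemovable e λs i) ×
     (n < m ⇔ HasAddable e λs i)) ×
    (HasAddable e λs i ⊎ HasRemovable e λs i)
propositionA7 (suc (suc k)) (s≤s (s≤s z≤n)) w λs abacus-of-w i n m ℓ[w]≡n@((ws , _ , ⟦ws⟧≗w) , _) ℓ[sw]≡m =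
  (⇔-trans m<n⇔Q<P (⇔-sym removable⇔Q<P) , ⇔-trans n<m⇔P<Q (⇔-sym addable⇔P<Q)) ,
  Sum.map (Equivalence.from addable⇔P<Q) (Equivalence.from removable⇔Q<P) P<Q⊎Q<P
  where
  open Affine k
  open LeftMultiplication ws i using (P<Q⊎Q<P)
  abacus : ∀ c y → InAbacus (λs c) y ⇔ ImageOfEmptyAbacus ⟦ ws ⟧ (+ toℕ c) y
  abacus c y = ⇔-trans (abacus-of-w c y) (image-cong (sym ∘ ⟦ws⟧≗w) (+ toℕ c) y)
  addable⇔P<Q = has-addable⇔P<Q λs ws i abacus
  removable⇔Q<P = has-removable⇔Q<P λs ws i abacus
  change = length-change ws i ⟦ws⟧≗w ℓ[w]≡n ℓ[sw]≡m
  comparison = length-comparison (proj₁ change) (proj₂ change) P<Q⊎Q<P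
  m<n⇔Q<P = proj₁ comparison
  n<m⇔P<Q = proj₂ comparison
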